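{- Let $m \geq 1$ be an integer and $n = 10 + 6m$. Construct the graph $G^*_{n,4}$ as follows: (1) take two vertex-disjoint copies $P_1$ and $P_{m+2}$ of the complete graph $K_5$, each with vertices labelled $1,2,3,4,5$, and $m$ further vertex-disjoint copies $P_2, \ldots, P_{m+1}$ of the cocktail party graph of order 3, each with vertices labelled $1,\ldots,6$ so that it is the complete graph on $\{1,\ldots,6\}$ minus the three edges $(1,4)$, $(2,5)$, $(3,6)$; (2) delete the edge $(1,2)$ from $P_1$ and the edge $(1,5)$ from $P_{m+2}$; (3) delete the edges $(1,2)$ and $(1,5)$ from each of $P_2, \ldots, P_{m+1}$; (4) for each $i = 1, \ldots, m+1$, add an edge between vertex $1$ of $P_i$ and vertex $1$ of $P_{i+1}$, and an edge between vertex $2$ of $P_i$ and vertex $5$ of $P_{i+1}$. Then $G^*_{n,4}$ is a $4$-regular graph on $n$ vertices whose number of Hamiltonian cycles is $36 \cdot 2^m = 9 \cdot 2^{\frac{n+2}{6}}$.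
   Context: The cocktail party graph of order $l$ is the complete graph on $2l$ vertices minus a perfect matching. A Hamiltonian cycle of a graph on $n$ vertices is a simple cycle through all $n$ vertices, counted as an undirected cycle (as a subgraph). -}

module Defs where

open import Data.Nat using (ℕ; zero; suc; _+_; _*_; _≡ᵇ_)
open import Data.Fin using (Fin; toℕ)
open import Data.Bool using (Bool; true; false; _∧_; _∨_; not; T)
open import Data.List using (List; []; _∷_)
open import Data.Bool.ListAction using (any)
open import Data.Vec using (Vec; toList)
open import Data.Product using (Σ)

-- Vertices of G*_{n,4} for a given m.
--   first a   : vertex (a+1) of P_1        (a : Fin 5, labels 1..5)
--   mid k a   : vertex (a+1) of P_{k+2}    (k : Fin m, a : Fin 6, labels 1..6)
--   last a    : vertex (a+1) of P_{m+2}    (a : Fin 5, labels 1..5)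
data Loc (m : ℕ) : Set where
  first : Fin 5 → Loc m
  mid   : Fin m → Fin 6 → Loc m
  last  : Fin 5 → Loc m

-- block index: P_i has index i-1 (so P_1 ↦ 0, P_{k+2} ↦ k+1, P_{m+2} ↦ m+1)
blk : {m : ℕ} → Loc m → ℕ
blk (first _) = 0
blk (mid k _) = suc (toℕ k)
blk {m} (last _) = suc m

-- 0-based label (label ℓ in the paper is ℓ-1 here)
lab : {m : ℕ} → Loc m → ℕ
lab (first a) = toℕ a
lab (mid _ a) = toℕ a
lab (last a)  = toℕ a

eqLoc : {m : ℕ} → Loc m → Loc m → Bool
eqLoc (first a) (first b) = toℕ a ≡ᵇ toℕ b
eqLoc (mid j a) (mid k b) = (toℕ j ≡ᵇ toℕ k) ∧ (toℕ a ≡ᵇ toℕ b)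
eqLoc (last a)  (last b)  = toℕ a ≡ᵇ toℕ b
eqLoc _ _ = false

pair : ℕ → ℕ → ℕ → ℕ → Bool
pair a b x y = ((a ≡ᵇ x) ∧ (b ≡ᵇ y)) ∨ ((a ≡ᵇ y) ∧ (b ≡ᵇ x))

-- edges inside a block, after the deletions of steps (2),(3):
--   P_1     : K_5 minus (1,2)
--   P_2..P_{m+1} : K_6 minus (1,4),(2,5),(3,6) [cocktail party CP(3)] minus (1,2),(1,5)
--   P_{m+2} : K_5 minus (1,5)
inBlock : {m : ℕ} → Loc m → Loc m → Bool
inBlock (first a) (first b) =
  not (toℕ a ≡ᵇ toℕ b) ∧ not (pair (toℕ a) (toℕ b) 0 1)
inBlock (mid j a) (mid k b) =
  (toℕ j ≡ᵇ toℕ k) ∧ not (toℕ a ≡ᵇ toℕ b)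
  ∧ not (pair (toℕ a) (toℕ b) 0 3) ∧ not (pair (toℕ a) (toℕ b) 1 4)
  ∧ not (pair (toℕ a) (toℕ b) 2 5)
  ∧ not (pair (toℕ a) (toℕ b) 0 1) ∧ not (pair (toℕ a) (toℕ b) 0 4)
inBlock (last a) (last b) =
  not (toℕ a ≡ᵇ toℕ b) ∧ not (pair (toℕ a) (toℕ b) 0 4)
inBlock _ _ = false

-- step (4): u in P_i, v in P_{i+1}; vertex 1 of P_i – vertex 1 of P_{i+1},
-- vertex 2 of P_i – vertex 5 of P_{i+1}
crossDir : {m : ℕ} → Loc m → Loc m → Bool
crossDir u v =
  (blk v ≡ᵇ suc (blk u))
  ∧ (((lab u ≡ᵇ 0) ∧ (lab v ≡ᵇ 0)) ∨ ((lab u ≡ᵇ 1) ∧ (lab v ≡ᵇ 4)))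

adj : {m : ℕ} → Loc m → Loc m → Bool
adj u v = inBlock u v ∨ crossDir u v ∨ crossDir v u

-- Hamiltonian cycles, represented by vertex sequences (v_0,…,v_{n-1})
-- with pairwise distinct entries, v_i ~ v_{i+1} and v_{n-1} ~ v_0.
distinct : {m : ℕ} → List (Loc m) → Bool
distinct [] = true
distinct (x ∷ xs) = not (any (eqLoc x) xs) ∧ distinct xs

chainTo : {m : ℕ} → Loc m → List (Loc m) → Bool
chainTo x₀ [] = true
chainTo x₀ (x ∷ []) = adj x x₀
chainTo x₀ (x ∷ y ∷ rest) = adj x y ∧ chainTo x₀ (y ∷ rest)

isCycleSeq : {m : ℕ} → List (Loc m) → Bool
isCycleSeq [] = true
isCycleSeq (x ∷ xs) = distinct (x ∷ xs) ∧ chainTo x (x ∷ xs)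

nV : ℕ → ℕ
nV m = 10 + 6 * m

-- Each undirected Hamiltonian cycle corresponds to exactly 2n such sequences
-- (n starting points × 2 directions), since n ≥ 3.
HamSeq : ℕ → Set
HamSeq m = Σ (Vec (Loc m) (nV m)) (λ v → T (isCycleSeq (toList v)))

Nbr : {m : ℕ} → Loc m → Set
Nbr {m} v = Σ (Loc m) (λ w → T (adj v w))

{-# OPTIONS --safe #-}
-- The only edges between blocks join vertex 1 of P_i to vertex 1 of P_(i+1) and vertex 2 of P_i to vertex 5
-- of P_(i+1), so a Hamiltonian cycle crosses each cut between consecutive blocks through exactly these two
-- edges.  Read from vertex 1 of P_1 into P_1, the cycle therefore runs through 3, 4, 5 of P_1 in some order
-- to vertex 2, crosses to vertex 5 of P_2, and comes back to vertex 1 of P_1 from vertex 1 of P_2 at the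
-- very end.  Recursively, in each cocktail-party block it runs from vertex 5 through 3, 4, 6 (4 in the
-- middle, since 3 and 6 are not adjacent) to vertex 2, and returns later through vertex 1; in P_(m+2) it
-- runs from vertex 5 through 2, 3, 4 in some order to vertex 1.  This gives 3! · 2^m · 3! cycles, and each
-- of them is written as a vertex sequence in 2n ways (starting vertex and direction).  Labels in the code
-- are 0-based.
module Submission where

open import Defs
open import Data.Nat using (ℕ; _+_; _*_; _^_; _≤_; _/_)
open import Data.Fin using (Fin)
open import Data.Product using (_×_)
open import Function.Bundles using (_↔_)
open import Relation.Binary.PropositionalEquality using (_≡_)

open import Data.Bool using (Bool; true; false; T; not; _∧_; _∨_; if_then_else_)
open import Data.Bool.ListAction using (any)
open import Data.Bool.Properties using (T-∧; T-∨; ∧-comm; ∨-comm; T-irrelevant)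
open import Data.Empty using (⊥; ⊥-elim)
open import Data.Fin using (zero; suc; toℕ; fromℕ<; inject₁)
open import Data.Fin.Patterns using (0F; 1F; 2F; 3F; 4F; 5F)
open import Data.Fin.Properties
  using (toℕ-injective; toℕ<n; toℕ-fromℕ<; toℕ-inject₁; all?; any?; +↔⊎; *↔×; 2↔Bool)
  renaming (_≟_ to _≟ᶠ_)
open import Data.List
  using (List; []; _∷_; [_]; _++_; _∷ʳ_; _ʳ++_; length; map; reverse; filter; lookup; take; drop; allFin;
         initLast; _∷ʳ′_)
open import Data.List.Membership.DecPropositional using () renaming (_∈?_ to ∈?)
open import Data.List.Membership.Propositional using (_∈_; _∉_)
open import Data.List.Membership.Propositional.Properties
  using (∈-∃++; ∈-++⁻; ∈-++⁺ˡ; ∈-++⁺ʳ; ∈-allFin; ∈-map⁺; ∈-map⁻; ∈-lookup;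
         ∈-filter⁺; ∈-filter⁻)
open import Data.List.Properties
  using (≡-dec; ∷-injective; ∷-injectiveˡ; ∷-injectiveʳ; ∷ʳ-injectiveˡ; ++-assoc; ++-identityʳ; ++-cancelʳ;
         length-++; length-++-sucʳ; length-++-comm; length-map; length-tabulate; length-drop; length-reverse;
         map-++; map-injective; take++drop≡id; unfold-reverse; reverse-++; reverse-involutive; reverse-injective)
open import Data.List.Relation.Binary.Disjoint.Propositional using (Disjoint)
open import Data.List.Relation.Binary.Permutation.Propositional using (_↭_; prep; ↭-sym; ↭⇒↭ₛ)
open import Data.List.Relation.Binary.Permutation.Propositional.Properties using (++-comm; ↭-reverse; ∈-resp-↭)
import Data.List.Relation.Binary.Permutation.Setoid.Properties as Permutation
open import Data.List.Relation.Binary.Subset.Propositional using (_⊆_)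
open import Data.List.Relation.Unary.All as All using (All; []; _∷_)
import Data.List.Relation.Unary.All.Properties as All
open import Data.List.Relation.Unary.AllPairs as AllPairs using ([]; _∷_; allPairs?)
open import Data.List.Relation.Unary.Any as Any using (here; there)
open import Data.List.Relation.Unary.Any.Properties using (any⁺; any⁻; lookup-index)
open import Data.List.Relation.Unary.First using () renaming (first to first-failure; _++_∷_ to _++ᶠ_∷_)
open import Data.List.Relation.Unary.First.Properties using (toView)
open import Data.List.Relation.Unary.Linked as Linked using (Linked; []; [-]; _∷_; linked?)
import Data.List.Relation.Unary.Linked.Properties as Linked
open import Data.List.Relation.Unary.Unique.Propositional using (Unique)
import Data.List.Relation.Unary.Unique.Propositional.Properties as Unique
open import Data.Nat using (zero; suc; pred; _<_; _∸_; _≡ᵇ_; z≤n; s≤s; s≤s⁻¹)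
open import Data.Nat.DivMod using (m*n/n≡m)
import Data.Nat.Properties as ℕ
open import Data.Nat.Properties
  using (≤-refl; ≤-reflexive; ≤-trans; ≤-antisym; <-irrefl; <-asym; <⇒≢; n<1+n; n≤1+n; m≤n+m; +-suc;
         +-identityʳ; suc-injective; m+n∸n≡m; m∸[m∸n]≡n; ≡ᵇ⇒≡; ≡⇒≡ᵇ)
open import Data.Nat.Tactic.RingSolver using (solve-∀)
open import Data.Product using (Σ; ∃; ∃₂; _,_; proj₁; proj₂; map₁)
open import Data.Product.Function.NonDependent.Propositional using (_×-↔_)
open import Data.Sum using (_⊎_; inj₁; inj₂; swap)
open import Data.Sum.Function.Propositional using (_⊎-↔_)
open import Data.Unit using (⊤; tt)
open import Data.Vec using (Vec; []; _∷_; cast; fromList; toList)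

open import Data.Vec.Properties using (toList-cast; toList∘fromList; toList-injective; length-toList; cast-is-id)
open import Data.Vec.Recursive using (lift↔; Fin[m^n]↔Fin[m]^n)
open import Data.Vec.Recursive.Properties using (↔Vec)
open import Function.Base using (id; _∘_)
open import Function.Bundles using (Equivalence; Inverse; mk↔ₛ′)
open import Function.Properties.Inverse using (↔-refl; ↔-sym; ↔-trans)
open import Relation.Binary.Definitions using (Symmetric; DecidableEquality)
open import Relation.Binary.PropositionalEquality
  using (_≢_; refl; sym; trans; cong; cong₂; subst; setoid; module ≡-Reasoning)
open import Relation.Nullary using (¬_; Dec; yes; no; contradiction)
open import Relation.Nullary.Decidable using (map′; T?; ¬?; toSum; from-yes; _→-dec_; _⊎-dec_)

module _ {A : Set} where

  Unique-↭ : {xs ys : List A} → xs ↭ ys → Unique xs → Unique ys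
  Unique-↭ = Permutation.Unique-resp-↭ (setoid A) ∘ ↭⇒↭ₛ

  Unique-++⁻ˡ : ∀ xs {ys : List A} → Unique (xs ++ ys) → Unique xs
  Unique-++⁻ˡ []       _          = []
  Unique-++⁻ˡ (x ∷ xs) (x≢ ∷ !xs) = All.++⁻ˡ xs x≢ ∷ Unique-++⁻ˡ xs !xs

  Unique-++⁻ʳ : ∀ xs {ys : List A} → Unique (xs ++ ys) → Unique ys
  Unique-++⁻ʳ []       !ys       = !ys
  Unique-++⁻ʳ (x ∷ xs) (_ ∷ !xs) = Unique-++⁻ʳ xs !xs

  Unique-++⁻-disjoint : ∀ xs {ys : List A} → Unique (xs ++ ys) → Disjoint xs ys
  Unique-++⁻-disjoint (x ∷ xs) (x≢ ∷ _)   (here refl , y∈ys)  = All.lookup x≢ (∈-++⁺ʳ xs y∈ys) refl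
  Unique-++⁻-disjoint (x ∷ xs) (_ ∷ !xs) (there y∈xs , y∈ys) = Unique-++⁻-disjoint xs !xs (y∈xs , y∈ys)

  Unique-∷ʳ⁺ : ∀ {xs : List A} {y} → Unique xs → y ∉ xs → Unique (xs ∷ʳ y)
  Unique-∷ʳ⁺ !xs y∉xs = Unique.++⁺ !xs ([] ∷ []) λ { (y∈xs , here refl) → y∉xs y∈xs }

  Unique-∷ʳ⁻ : ∀ xs {y : A} → Unique (xs ∷ʳ y) → y ∉ xs
  Unique-∷ʳ⁻ (x ∷ xs) (x≢ ∷ _)   (here refl) = All.lookup x≢ (∈-++⁺ʳ xs (here refl)) refl
  Unique-∷ʳ⁻ (x ∷ xs) (_ ∷ !xs) (there y∈)  = Unique-∷ʳ⁻ xs !xs y∈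

  Unique⇒lookup-injective : ∀ {xs : List A} → Unique xs → ∀ {i j} → lookup xs i ≡ lookup xs j → i ≡ j
  Unique⇒lookup-injective {_ ∷ _} _ {zero}  {zero}  _  = refl
  Unique⇒lookup-injective (x≢ ∷ _)  {zero}  {suc j} eq = contradiction eq (All.lookup x≢ (∈-lookup j))
  Unique⇒lookup-injective (x≢ ∷ _)  {suc i} {zero}  eq = contradiction (sym eq) (All.lookup x≢ (∈-lookup i))
  Unique⇒lookup-injective (_ ∷ !xs) {suc i} {suc j} eq = cong suc (Unique⇒lookup-injective !xs eq)

  Unique-⊆⇒length≤ : {xs ys : List A} → Unique xs → xs ⊆ ys → length xs ≤ length ys
  Unique-⊆⇒length≤ {[]}     _            _     = z≤n
  Unique-⊆⇒length≤ {x ∷ xs} (x≢xs ∷ !xs) xs⊆ys with ∈-∃++ (xs⊆ys (here refl))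
  ... | ys₁ , ys₂ , refl =
    subst (suc (length xs) ≤_) (sym (length-++-sucʳ ys₁ x ys₂)) (s≤s (Unique-⊆⇒length≤ !xs xs⊆ys₁++ys₂))
    where
      xs⊆ys₁++ys₂ : xs ⊆ ys₁ ++ ys₂
      xs⊆ys₁++ys₂ y∈xs with ∈-++⁻ ys₁ (xs⊆ys (there y∈xs))
      ... | inj₁ y∈ys₁         = ∈-++⁺ˡ y∈ys₁
      ... | inj₂ (here refl)   = contradiction refl (All.lookup x≢xs y∈xs)
      ... | inj₂ (there y∈ys₂) = ∈-++⁺ʳ ys₁ y∈ys₂

  Unique-length⇒complete : DecidableEquality A → (xs ys : List A) → (∀ x → x ∈ xs) →
                           Unique ys → length xs ≤ length ys → ∀ y → y ∈ ys
  Unique-length⇒complete _≟_ xs ys xs-complete !ys |xs|≤|ys| y with ∈? _≟_ y ys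
  ... | yes y∈ys = y∈ys
  ... | no  y∉ys = contradiction
    (Unique-⊆⇒length≤ (All.¬Any⇒All¬ ys y∉ys ∷ !ys) (λ {z} _ → xs-complete z))
    (λ |y∷ys|≤|xs| → <-irrefl refl (≤-trans |y∷ys|≤|xs| |xs|≤|ys|))

  ∷⇒∷ʳ : ∀ (x : A) xs → ∃₂ λ ys y → x ∷ xs ≡ ys ∷ʳ y
  ∷⇒∷ʳ x []        = [] , x , refl
  ∷⇒∷ʳ x (x′ ∷ xs) with ∷⇒∷ʳ x′ xs
  ... | ys , y , eq = x ∷ ys , y , cong (x ∷_) eq

  ∈-∷ʳ-repeat : ∀ {x y : A} ys → x ∈ y ∷ ys ∷ʳ y → x ∈ y ∷ ys
  ∈-∷ʳ-repeat {y = y} ys x∈ with ∈-++⁻ (y ∷ ys) x∈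
  ... | inj₁ x∈ys        = x∈ys
  ... | inj₂ (here refl) = here refl

  length-∷ʳ : ∀ (xs : List A) {x} → length (xs ∷ʳ x) ≡ suc (length xs)
  length-∷ʳ []       = refl
  length-∷ʳ (_ ∷ xs) = cong suc (length-∷ʳ xs)

  length<length-++-∷ : ∀ (xs : List A) {y ys} → length xs < length (xs ++ y ∷ ys)
  length<length-++-∷ []       = s≤s z≤n
  length<length-++-∷ (_ ∷ xs) = s≤s (length<length-++-∷ xs)

  length≡3 : ∀ (xs : List A) → length xs ≡ 3 → ∃₂ λ p q → ∃ λ r → xs ≡ p ∷ q ∷ r ∷ []
  length≡3 (p ∷ q ∷ r ∷ []) refl = p , q , r , refl

  take-length-++ : ∀ (xs : List A) {ys} → take (length xs) (xs ++ ys) ≡ xs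
  take-length-++ []       = refl
  take-length-++ (x ∷ xs) = cong (x ∷_) (take-length-++ xs)

  drop-length-++ : ∀ (xs : List A) {ys} → drop (length xs) (xs ++ ys) ≡ ys
  drop-length-++ []       = refl
  drop-length-++ (x ∷ xs) = drop-length-++ xs

  ++-injective : ∀ (xs ys : List A) {zs ws} → length xs ≡ length ys →
                 xs ++ zs ≡ ys ++ ws → xs ≡ ys × zs ≡ ws
  ++-injective []       []       _         eq = refl , eq
  ++-injective (x ∷ xs) (y ∷ ys) |xs|≡|ys| eq with ∷-injective eq
  ... | refl , eq′ = map₁ (cong (x ∷_)) (++-injective xs ys (suc-injective |xs|≡|ys|) eq′)

  ++-∷-injective : ∀ (xs ys : List A) {x xs′ ys′} → x ∉ xs → x ∉ ys →
                   xs ++ x ∷ xs′ ≡ ys ++ x ∷ ys′ → xs ≡ ys × xs′ ≡ ys′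
  ++-∷-injective []       []        _    _    eq = refl , ∷-injectiveʳ eq
  ++-∷-injective []       (y ∷ ys)  _    x∉ys eq = contradiction (here (∷-injectiveˡ eq)) x∉ys
  ++-∷-injective (y ∷ xs) []        x∉xs _    eq = contradiction (here (sym (∷-injectiveˡ eq))) x∉xs
  ++-∷-injective (y ∷ xs) (y′ ∷ ys) x∉xs x∉ys eq with ∷-injective eq
  ... | refl , eq′ = map₁ (cong (y ∷_)) (++-∷-injective xs ys (x∉xs ∘ there) (x∉ys ∘ there) eq′)

  -- rotateTo k (x ∷ xs) is the rotation of x ∷ xs that puts x at position k, provided k ≤ length xs
  rotateTo : ℕ → List A → List A
  rotateTo k []       = []
  rotateTo k (x ∷ xs) = drop (length xs ∸ k) xs ++ x ∷ take (length xs ∸ k) xs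

  rotateTo-split : ∀ (x : A) xs ys → rotateTo (length ys) (x ∷ xs ++ ys) ≡ ys ++ x ∷ xs
  rotateTo-split x xs ys rewrite length-++ xs {ys} | m+n∸n≡m (length xs) (length ys) =
    cong₂ (λ zs zs′ → zs ++ x ∷ zs′) (drop-length-++ xs) (take-length-++ xs)

  length-rotateTo : ∀ k (xs : List A) → length (rotateTo k xs) ≡ length xs
  length-rotateTo k []       = refl
  length-rotateTo k (x ∷ xs) =
    trans (length-++-comm (drop t xs) (x ∷ take t xs)) (cong (suc ∘ length) (take++drop≡id t xs))
    where t = length xs ∸ k

  rotateTo-injective : ∀ {x : A} {xs ys} k l → k ≤ length xs → l ≤ length ys →
                       Unique (rotateTo k (x ∷ xs)) → Unique (rotateTo l (x ∷ ys)) →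
                       rotateTo k (x ∷ xs) ≡ rotateTo l (x ∷ ys) → k ≡ l × xs ≡ ys
  rotateTo-injective {x} {xs} {ys} k l k≤ l≤ !xs !ys eq
    with ++-∷-injective (drop s xs) (drop t ys) (λ x∈ → Unique-++⁻-disjoint (drop s xs) !xs (x∈ , here refl))
                                                 (λ x∈ → Unique-++⁻-disjoint (drop t ys) !ys (x∈ , here refl)) eq
    where s = length xs ∸ k
          t = length ys ∸ l
  ... | drops≡ , takes≡ =
    trans (sym (length-drop-∸ xs k≤)) (trans (cong length drops≡) (length-drop-∸ ys l≤)) ,
    trans (sym (take++drop≡id (length xs ∸ k) xs))
          (trans (cong₂ _++_ takes≡ drops≡) (take++drop≡id (length ys ∸ l) ys))
    where
      length-drop-∸ : ∀ zs {n} → n ≤ length zs → length (drop (length zs ∸ n) zs) ≡ n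
      length-drop-∸ zs {n} n≤ = trans (length-drop (length zs ∸ n) zs) (m∸[m∸n]≡n n≤)

  orient : Bool → List A → List A
  orient d []       = []
  orient d (x ∷ xs) = x ∷ (if d then reverse xs else xs)

  length-orient : ∀ d (xs : List A) → length (orient d xs) ≡ length xs
  length-orient d     []       = refl
  length-orient false (x ∷ xs) = refl
  length-orient true  (x ∷ xs) = cong suc (length-reverse xs)

All-preimage : {A B : Set} (f : B → A) → ∀ {xs} → All (λ x → ∃ λ b → x ≡ f b) xs →
               ∃ λ bs → xs ≡ map f bs
All-preimage f []                = [] , refl
All-preimage f ((b , refl) ∷ ps) with All-preimage f ps
... | bs , refl = b ∷ bs , refl

Unique-complete⇒length≡ : ∀ {n} {xs : List (Fin n)} → Unique xs → (∀ x → x ∈ xs) → length xs ≡ n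
Unique-complete⇒length≡ {n} {xs} !xs complete = ≤-antisym
  (subst (length xs ≤_) (length-tabulate id) (Unique-⊆⇒length≤ !xs (λ {x} _ → ∈-allFin x)))
  (subst (_≤ length xs) (length-tabulate id) (Unique-⊆⇒length≤ (Unique.allFin⁺ n) (λ {x} _ → complete x)))

module _ {A : Set} {R : A → A → Set} where

  Linked-split : ∀ xs {y : A} {ys} → Linked R (xs ++ y ∷ ys) → Linked R (xs ∷ʳ y) × Linked R (y ∷ ys)
  Linked-split []            l       = [-] , l
  Linked-split (x ∷ [])      (r ∷ l) = r ∷ [-] , l
  Linked-split (x ∷ x′ ∷ xs) (r ∷ l) = map₁ (r ∷_) (Linked-split (x′ ∷ xs) l)

  Linked-join : ∀ xs {y : A} {ys} → Linked R (xs ∷ʳ y) → Linked R (y ∷ ys) → Linked R (xs ++ y ∷ ys)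
  Linked-join []            _         l = l
  Linked-join (x ∷ [])      (r ∷ [-]) l = r ∷ l
  Linked-join (x ∷ x′ ∷ xs) (r ∷ l₁)  l = r ∷ Linked-join (x′ ∷ xs) l₁ l

  Linked-∷ʳ-++ : ∀ xs {y : A} {ys} → Linked R (xs ∷ʳ y) → Linked R (y ∷ ys) → Linked R ((xs ∷ʳ y) ++ ys)
  Linked-∷ʳ-++ xs {y} {ys} l₁ l₂ = subst (Linked R) (sym (++-assoc xs [ y ] ys)) (Linked-join xs l₁ l₂)

  Linked-++⁻ˡ : ∀ xs {ys : List A} → Linked R (xs ++ ys) → Linked R xs
  Linked-++⁻ˡ []            _       = []
  Linked-++⁻ˡ (x ∷ [])      _       = [-]
  Linked-++⁻ˡ (x ∷ x′ ∷ xs) (r ∷ l) = r ∷ Linked-++⁻ˡ (x′ ∷ xs) l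

  Linked-++⁻ʳ : ∀ xs {ys : List A} → Linked R (xs ++ ys) → Linked R ys
  Linked-++⁻ʳ []       l = l
  Linked-++⁻ʳ (x ∷ xs) l = Linked-++⁻ʳ xs (Linked.tail l)

  Linked-consecutive : ∀ xs {u v : A} {ys} → Linked R ((xs ∷ʳ u) ++ v ∷ ys) → R u v
  Linked-consecutive []            (r ∷ _) = r
  Linked-consecutive (x ∷ [])      (_ ∷ l) = Linked-consecutive [] l
  Linked-consecutive (x ∷ x′ ∷ xs) (_ ∷ l) = Linked-consecutive (x′ ∷ xs) l

  Linked-ʳ++ : Symmetric R → ∀ xs {x : A} {acc} → Linked R (x ∷ xs) → Linked R (x ∷ acc) →
               Linked R ((x ∷ xs) ʳ++ acc)
  Linked-ʳ++ sym-R []       _       l  = l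
  Linked-ʳ++ sym-R (y ∷ ys) (r ∷ l) l′ = Linked-ʳ++ sym-R ys l (sym-R r ∷ l′)

  Linked-reverse : Symmetric R → ∀ {xs} → Linked R xs → Linked R (reverse xs)
  Linked-reverse sym-R {[]}     _ = []
  Linked-reverse sym-R {x ∷ xs} l = Linked-ʳ++ sym-R xs l [-]

IsCycle : {A : Set} → (A → A → Set) → List A → Set
IsCycle _ []       = ⊤
IsCycle R (x ∷ xs) = Unique (x ∷ xs) × Linked R (x ∷ xs ∷ʳ x)

module _ {A : Set} {R : A → A → Set} where

  IsCycle⇒Unique : ∀ {xs} → IsCycle R xs → Unique xs
  IsCycle⇒Unique {[]}    _         = []
  IsCycle⇒Unique {_ ∷ _} (!xs , _) = !xs

  IsCycle-rotate : ∀ xs ys → IsCycle R (xs ++ ys) → IsCycle R (ys ++ xs)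
  IsCycle-rotate []       ys       c rewrite ++-identityʳ ys = c
  IsCycle-rotate (x ∷ xs) []       c rewrite ++-identityʳ xs = c
  IsCycle-rotate (x ∷ xs) (y ∷ ys) (!xys , l) =
    Unique-↭ (++-comm (x ∷ xs) (y ∷ ys)) !xys ,
    subst (Linked R) (sym (++-assoc (y ∷ ys) (x ∷ xs) [ y ])) (Linked-join (y ∷ ys) (proj₂ halves) (proj₁ halves))
    where
      halves = Linked-split (x ∷ xs) (subst (Linked R) (++-assoc (x ∷ xs) (y ∷ ys) [ x ]) l)

  IsCycle-rotateTo : ∀ k xs → IsCycle R xs → IsCycle R (rotateTo k xs)
  IsCycle-rotateTo k []       c = c
  IsCycle-rotateTo k (x ∷ xs) c =
    IsCycle-rotate (x ∷ take t xs) (drop t xs) (subst (IsCycle R ∘ (x ∷_)) (sym (take++drop≡id t xs)) c)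
    where t = length xs ∸ k

  IsCycle-reverse : Symmetric R → ∀ x xs → IsCycle R (x ∷ xs) → IsCycle R (x ∷ reverse xs)
  IsCycle-reverse sym-R x xs (!xs , l) =
    Unique-↭ (prep x (↭-sym (↭-reverse xs))) !xs , subst (Linked R) reverse-closed (Linked-reverse sym-R l)
    where
      open ≡-Reasoning
      reverse-closed : reverse (x ∷ xs ∷ʳ x) ≡ x ∷ reverse xs ∷ʳ x
      reverse-closed = begin
        reverse ((x ∷ xs) ++ [ x ]) ≡⟨ reverse-++ (x ∷ xs) [ x ] ⟩
        x ∷ reverse (x ∷ xs)        ≡⟨ cong (x ∷_) (unfold-reverse x xs) ⟩
        x ∷ reverse xs ∷ʳ x         ∎

  IsCycle-orient : Symmetric R → ∀ d xs → IsCycle R xs → IsCycle R (orient d xs)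
  IsCycle-orient sym-R d     []       c = c
  IsCycle-orient sym-R false (x ∷ xs) c = c
  IsCycle-orient sym-R true  (x ∷ xs) c = IsCycle-reverse sym-R x xs c

Σ↔-injection : {A B : Set} {P : A → Set} (f : B → A) → (∀ {b b′} → f b ≡ f b′ → b ≡ b′) →
               (∀ b → P (f b)) → (∀ {a} → P a → ∃ λ b → f b ≡ a) → (∀ {a} (p q : P a) → p ≡ q) →
               Σ A P ↔ B
Σ↔-injection {A} {B} {P} f f-injective f-in-P f-onto P-irrelevant =
  mk↔ₛ′ to (λ b → f b , f-in-P b) (λ b → f-injective (proj₂ (f-onto (f-in-P b)))) from∘to
  where
    to : Σ A P → B
    to (_ , p) = proj₁ (f-onto p)
    from∘to : ∀ ap → (f (to ap) , f-in-P (to ap)) ≡ ap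
    from∘to (a , p) with f-onto p
    ... | b , refl = cong (f b ,_) (P-irrelevant _ _)

Σ↔Fin-enumeration : {A : Set} {P : A → Set} (xs : List A) → Unique xs →
                    (∀ {x} → P x → x ∈ xs) → (∀ {x} → x ∈ xs → P x) →
                    (∀ {x} (p q : P x) → p ≡ q) →
                    Σ A P ↔ Fin (length xs)
Σ↔Fin-enumeration xs !xs P⇒∈ ∈⇒P P-irrelevant =
  Σ↔-injection (lookup xs) (Unique⇒lookup-injective !xs) (λ i → ∈⇒P (∈-lookup i))
    (λ px → Any.index (P⇒∈ px) , sym (lookup-index (P⇒∈ px))) P-irrelevant

T-∧⁻ : ∀ {a b} → T (a ∧ b) → T a × T b
T-∧⁻ = Equivalence.to T-∧

T-∧⁺ : ∀ {a b} → T a → T b → T (a ∧ b)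
T-∧⁺ p q = Equivalence.from T-∧ (p , q)

T-∨⁻ : ∀ {a b} → T (a ∨ b) → T a ⊎ T b
T-∨⁻ = Equivalence.to T-∨

T-∨⁺ : ∀ {a b} → T a ⊎ T b → T (a ∨ b)
T-∨⁺ = Equivalence.from T-∨

T-not⁻ : ∀ {b} → T (not b) → ¬ T b
T-not⁻ {false} _ ()

T-not⁺ : ∀ {b} → ¬ T b → T (not b)
T-not⁺ {true}  ¬b = ¬b tt
T-not⁺ {false} _  = tt

T-≡ᵇ⁻ : ∀ {a b} → T (a ≡ᵇ b) → a ≡ b
T-≡ᵇ⁻ {a} {b} = ≡ᵇ⇒≡ a b

T-≡ᵇ⁺ : ∀ {a b} → a ≡ b → T (a ≡ᵇ b)
T-≡ᵇ⁺ {a} {b} = ≡⇒≡ᵇ a b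

≡ᵇ-sym : ∀ a b → (a ≡ᵇ b) ≡ (b ≡ᵇ a)
≡ᵇ-sym zero    zero    = refl
≡ᵇ-sym zero    (suc b) = refl
≡ᵇ-sym (suc a) zero    = refl
≡ᵇ-sym (suc a) (suc b) = ≡ᵇ-sym a b

pair-sym : ∀ a b x y → pair a b x y ≡ pair b a x y
pair-sym a b x y rewrite ∧-comm (a ≡ᵇ x) (b ≡ᵇ y) | ∧-comm (a ≡ᵇ y) (b ≡ᵇ x) =
  ∨-comm ((b ≡ᵇ y) ∧ (a ≡ᵇ x)) _

firstEdge midEdge lastEdge : ℕ → ℕ → Bool
firstEdge a b = not (a ≡ᵇ b) ∧ not (pair a b 0 1)
midEdge   a b = not (a ≡ᵇ b) ∧ not (pair a b 0 3) ∧ not (pair a b 1 4) ∧ not (pair a b 2 5)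
                ∧ not (pair a b 0 1) ∧ not (pair a b 0 4)
lastEdge  a b = not (a ≡ᵇ b) ∧ not (pair a b 0 4)

LabelEdge : (ℕ → ℕ → Bool) → ∀ {k} → Fin k → Fin k → Set
LabelEdge e a b = T (e (toℕ a) (toℕ b))

labelEdge? : ∀ e {k} (a b : Fin k) → Dec (LabelEdge e a b)
labelEdge? e a b = T? (e (toℕ a) (toℕ b))

inBlock-sym : ∀ {m} (u v : Loc m) → inBlock u v ≡ inBlock v u
inBlock-sym (first a) (first b) rewrite ≡ᵇ-sym (toℕ a) (toℕ b) | pair-sym (toℕ a) (toℕ b) 0 1 = refl
inBlock-sym (mid j a) (mid k b)
  rewrite ≡ᵇ-sym (toℕ j) (toℕ k) | ≡ᵇ-sym (toℕ a) (toℕ b)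
        | pair-sym (toℕ a) (toℕ b) 0 3 | pair-sym (toℕ a) (toℕ b) 1 4 | pair-sym (toℕ a) (toℕ b) 2 5
        | pair-sym (toℕ a) (toℕ b) 0 1 | pair-sym (toℕ a) (toℕ b) 0 4 = refl
inBlock-sym (last a)  (last b) rewrite ≡ᵇ-sym (toℕ a) (toℕ b) | pair-sym (toℕ a) (toℕ b) 0 4 = refl
inBlock-sym (first _) (mid _ _) = refl
inBlock-sym (first _) (last _)  = refl
inBlock-sym (mid _ _) (first _) = refl
inBlock-sym (mid _ _) (last _)  = refl
inBlock-sym (last _)  (first _) = refl
inBlock-sym (last _)  (mid _ _) = refl

inBlock⇒same-blk : ∀ {m} (u v : Loc m) → T (inBlock u v) → blk u ≡ blk v
inBlock⇒same-blk (first _) (first _) _ = refl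
inBlock⇒same-blk (mid j _) (mid k _) e = cong suc (T-≡ᵇ⁻ (proj₁ (T-∧⁻ {toℕ j ≡ᵇ toℕ k} e)))
inBlock⇒same-blk (last _)  (last _)  _ = refl

data CutLabels (a b : ℕ) : Set where
  spine : a ≡ 0 → b ≡ 0 → CutLabels a b
  rung  : a ≡ 1 → b ≡ 4 → CutLabels a b

module _ {m : ℕ} where

  infix 4 _~_
  record _~_ (u v : Loc m) : Set where
    constructor edge
    field isEdge : T (adj u v)

  record Crossing (u v : Loc m) : Set where
    constructor crossing
    field
      next   : blk v ≡ suc (blk u)
      labels : CutLabels (lab u) (lab v)

  ~-sym : Symmetric _~_
  ~-sym {u} {v} (edge e) = edge (subst T adj-sym e)
    where
      adj-sym : adj u v ≡ adj v u
      adj-sym rewrite inBlock-sym u v | ∨-comm (crossDir u v) (crossDir v u) = refl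

  crossDir⇒Crossing : ∀ u v → T (crossDir u v) → Crossing u v
  crossDir⇒Crossing u v e with T-∧⁻ {blk v ≡ᵇ suc (blk u)} e
  ... | next , labels with T-∨⁻ {(lab u ≡ᵇ 0) ∧ (lab v ≡ᵇ 0)} labels
  ...   | inj₁ l = crossing (T-≡ᵇ⁻ next)
                     (spine (T-≡ᵇ⁻ (proj₁ (T-∧⁻ l))) (T-≡ᵇ⁻ (proj₂ (T-∧⁻ {lab u ≡ᵇ 0} l))))
  ...   | inj₂ l = crossing (T-≡ᵇ⁻ next)
                     (rung (T-≡ᵇ⁻ (proj₁ (T-∧⁻ l))) (T-≡ᵇ⁻ (proj₂ (T-∧⁻ {lab u ≡ᵇ 1} l))))

  Crossing⇒~ : ∀ {u v} → Crossing u v → u ~ v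
  Crossing⇒~ {u} {v} (crossing next labels) =
    edge (T-∨⁺ {inBlock u v} (inj₂ (T-∨⁺ (inj₁ (T-∧⁺ (T-≡ᵇ⁺ next) (cut labels))))))
    where
      cut : CutLabels (lab u) (lab v) →
            T (((lab u ≡ᵇ 0) ∧ (lab v ≡ᵇ 0)) ∨ ((lab u ≡ᵇ 1) ∧ (lab v ≡ᵇ 4)))
      cut (spine a b) = T-∨⁺ (inj₁ (T-∧⁺ (T-≡ᵇ⁺ a) (T-≡ᵇ⁺ b)))
      cut (rung a b)  = T-∨⁺ {(lab u ≡ᵇ 0) ∧ (lab v ≡ᵇ 0)} (inj₂ (T-∧⁺ (T-≡ᵇ⁺ a) (T-≡ᵇ⁺ b)))

  ~-cases : ∀ {u v} → u ~ v → T (inBlock u v) ⊎ Crossing u v ⊎ Crossing v u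
  ~-cases {u} {v} (edge e) with T-∨⁻ {inBlock u v} e
  ... | inj₁ i = inj₁ i
  ... | inj₂ c with T-∨⁻ {crossDir u v} c
  ...   | inj₁ c₁ = inj₂ (inj₁ (crossDir⇒Crossing u v c₁))
  ...   | inj₂ c₂ = inj₂ (inj₂ (crossDir⇒Crossing v u c₂))

  ~-upward : ∀ {u v} → u ~ v → blk u < blk v → Crossing u v
  ~-upward {u} {v} u~v u<v with ~-cases u~v
  ... | inj₁ same                     = contradiction (inBlock⇒same-blk u v same) (<⇒≢ u<v)
  ... | inj₂ (inj₁ c)                 = c
  ... | inj₂ (inj₂ (crossing next _)) = contradiction (subst (_< _) next u<v) (λ lt → <-asym lt (n<1+n _))

  first~ : ∀ {a b} → LabelEdge firstEdge a b → first a ~ first b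
  first~ e = edge (T-∨⁺ (inj₁ e))

  last~ : ∀ {a b} → LabelEdge lastEdge a b → last a ~ last b
  last~ e = edge (T-∨⁺ (inj₁ e))

  mid~ : ∀ {k a b} → LabelEdge midEdge a b → mid k a ~ mid k b
  mid~ {k} e = edge (T-∨⁺ (inj₁ (T-∧⁺ (T-≡ᵇ⁺ {toℕ k} refl) e)))

  mid~⁻ : ∀ {k a b} → mid k a ~ mid k b → LabelEdge midEdge a b
  mid~⁻ {k} {a} {b} k~ with ~-cases k~
  ... | inj₁ same                     = proj₂ (T-∧⁻ {toℕ k ≡ᵇ toℕ k} same)
  ... | inj₂ (inj₁ (crossing next _)) = contradiction next (<⇒≢ (n<1+n _))
  ... | inj₂ (inj₂ (crossing next _)) = contradiction next (<⇒≢ (n<1+n _))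

  first-injective : ∀ {a b} → first {m} a ≡ first b → a ≡ b
  first-injective refl = refl

  mid-injective : ∀ {k a b} → mid {m} k a ≡ mid k b → a ≡ b
  mid-injective refl = refl

  last-injective : ∀ {a b} → last {m} a ≡ last b → a ≡ b
  last-injective refl = refl

  blk-lab-injective : ∀ {x y : Loc m} → blk x ≡ blk y → lab x ≡ lab y → x ≡ y
  blk-lab-injective {first a} {first b} _ l = cong first (toℕ-injective l)
  blk-lab-injective {mid j a} {mid k b} p l = cong₂ mid (toℕ-injective (suc-injective p)) (toℕ-injective l)
  blk-lab-injective {mid j _} {last _}  p _ = contradiction (suc-injective p) (<⇒≢ (toℕ<n j))
  blk-lab-injective {last _}  {mid k _} p _ = contradiction (sym (suc-injective p)) (<⇒≢ (toℕ<n k))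
  blk-lab-injective {last a}  {last b}  _ l = cong last (toℕ-injective l)

  At : ℕ → ℕ → Loc m → Set
  At b l x = blk x ≡ b × lab x ≡ l

  At-unique : ∀ {b l x y} → At b l x → At b l y → x ≡ y
  At-unique (x-blk , x-lab) (y-blk , y-lab) = blk-lab-injective (trans x-blk (sym y-blk)) (trans x-lab (sym y-lab))

  eqLoc⇒≡ : ∀ (x y : Loc m) → T (eqLoc x y) → x ≡ y
  eqLoc⇒≡ (first a) (first b) e = cong first (toℕ-injective (T-≡ᵇ⁻ e))
  eqLoc⇒≡ (mid j a) (mid k b) e with T-∧⁻ {toℕ j ≡ᵇ toℕ k} e
  ... | j≡k , a≡b = cong₂ mid (toℕ-injective (T-≡ᵇ⁻ j≡k)) (toℕ-injective (T-≡ᵇ⁻ a≡b))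
  eqLoc⇒≡ (last a)  (last b)  e = cong last (toℕ-injective (T-≡ᵇ⁻ e))

  eqLoc-refl : ∀ (x : Loc m) → T (eqLoc x x)
  eqLoc-refl (first a) = T-≡ᵇ⁺ {toℕ a} refl
  eqLoc-refl (mid k a) = T-∧⁺ (T-≡ᵇ⁺ {toℕ k} refl) (T-≡ᵇ⁺ {toℕ a} refl)
  eqLoc-refl (last a)  = T-≡ᵇ⁺ {toℕ a} refl

  _≟_ : DecidableEquality (Loc m)
  x ≟ y = map′ (eqLoc⇒≡ x y) (λ { refl → eqLoc-refl x }) (T? (eqLoc x y))

  distinct⇒Unique : ∀ xs → T (distinct xs) → Unique xs
  distinct⇒Unique []       _ = []
  distinct⇒Unique (x ∷ xs) d with T-∧⁻ {not (any (eqLoc x) xs)} d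
  ... | x∉xs , d′ = All.tabulate x≢ ∷ distinct⇒Unique xs d′
    where
      x≢ : ∀ {y} → y ∈ xs → x ≢ y
      x≢ y∈xs refl = T-not⁻ x∉xs (any⁺ (eqLoc x) (Any.map (λ { refl → eqLoc-refl x }) y∈xs))

  Unique⇒distinct : ∀ xs → Unique xs → T (distinct xs)
  Unique⇒distinct []       _            = tt
  Unique⇒distinct (x ∷ xs) (x≢xs ∷ !xs) =
    T-∧⁺ (T-not⁺ (All.All¬⇒¬Any (All.map (_∘ eqLoc⇒≡ x _) x≢xs) ∘ any⁻ (eqLoc x) xs))
         (Unique⇒distinct xs !xs)

  chainTo⇒Linked : ∀ x₀ xs → T (chainTo x₀ xs) → Linked _~_ (xs ∷ʳ x₀)
  chainTo⇒Linked x₀ []           _ = [-]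
  chainTo⇒Linked x₀ (x ∷ [])     e = edge e ∷ [-]
  chainTo⇒Linked x₀ (x ∷ y ∷ xs) c =
    edge (proj₁ (T-∧⁻ {adj x y} c)) ∷ chainTo⇒Linked x₀ (y ∷ xs) (proj₂ (T-∧⁻ {adj x y} c))

  Linked⇒chainTo : ∀ x₀ xs → Linked _~_ (xs ∷ʳ x₀) → T (chainTo x₀ xs)
  Linked⇒chainTo x₀ []           _            = tt
  Linked⇒chainTo x₀ (x ∷ [])     (edge e ∷ _) = e
  Linked⇒chainTo x₀ (x ∷ y ∷ xs) (edge e ∷ l) = T-∧⁺ e (Linked⇒chainTo x₀ (y ∷ xs) l)

  isCycleSeq⇒IsCycle : ∀ xs → T (isCycleSeq xs) → IsCycle _~_ xs
  isCycleSeq⇒IsCycle []       _ = tt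
  isCycleSeq⇒IsCycle (x ∷ xs) c with T-∧⁻ {distinct (x ∷ xs)} c
  ... | d , l = distinct⇒Unique (x ∷ xs) d , chainTo⇒Linked x (x ∷ xs) l

  IsCycle⇒isCycleSeq : ∀ xs → IsCycle _~_ xs → T (isCycleSeq xs)
  IsCycle⇒isCycleSeq []       _        = tt
  IsCycle⇒isCycleSeq (x ∷ xs) (! , l) = T-∧⁺ (Unique⇒distinct (x ∷ xs) !) (Linked⇒chainTo x (x ∷ xs) l)

5+[m*6+5]≡10+6m : ∀ m → 5 + (m * 6 + 5) ≡ 10 + 6 * m
5+[m*6+5]≡10+6m = solve-∀

module _ {m : ℕ} where

  Loc↔⊎ : Loc m ↔ (Fin 5 ⊎ (Fin m × Fin 6) ⊎ Fin 5)
  Loc↔⊎ = mk↔ₛ′ to from to∘from from∘to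
    where
      to : Loc m → Fin 5 ⊎ (Fin m × Fin 6) ⊎ Fin 5
      to (first a) = inj₁ a
      to (mid k a) = inj₂ (inj₁ (k , a))
      to (last a)  = inj₂ (inj₂ a)
      from : Fin 5 ⊎ (Fin m × Fin 6) ⊎ Fin 5 → Loc m
      from (inj₁ a)              = first a
      from (inj₂ (inj₁ (k , a))) = mid k a
      from (inj₂ (inj₂ a))       = last a
      to∘from : ∀ x → to (from x) ≡ x
      to∘from (inj₁ _)        = refl
      to∘from (inj₂ (inj₁ _)) = refl
      to∘from (inj₂ (inj₂ _)) = refl
      from∘to : ∀ x → from (to x) ≡ x
      from∘to (first _) = refl
      from∘to (mid _ _) = refl
      from∘to (last _)  = refl

  Loc↔Fin : Loc m ↔ Fin (nV m)
  Loc↔Fin = subst (λ n → Loc m ↔ Fin n) (5+[m*6+5]≡10+6m m)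
    (↔-trans Loc↔⊎ (↔-sym (↔-trans +↔⊎ (↔-refl ⊎-↔ ↔-trans +↔⊎ (*↔× ⊎-↔ ↔-refl)))))

  -- opaque: with-abstractions would otherwise unfold the enumeration of all nV m vertices
  opaque
    allLoc : List (Loc m)
    allLoc = map (Inverse.from Loc↔Fin) (allFin (nV m))

    ∈-allLoc : ∀ x → x ∈ allLoc
    ∈-allLoc x =
      subst (_∈ allLoc) (Inverse.inverseʳ Loc↔Fin refl) (∈-map⁺ (Inverse.from Loc↔Fin) (∈-allFin _))

    length-allLoc : length allLoc ≡ nV m
    length-allLoc = trans (length-map (Inverse.from Loc↔Fin) (allFin (nV m))) (length-tabulate {n = nV m} id)

  Unique⇒complete : ∀ {xs : List (Loc m)} → Unique xs → length xs ≡ nV m → ∀ x → x ∈ xs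
  Unique⇒complete {xs} !xs |xs|≡n =
    Unique-length⇒complete _≟_ allLoc xs ∈-allLoc !xs (≤-reflexive (trans length-allLoc (sym |xs|≡n)))

unique? : ∀ {k} (ls : List (Fin k)) → Dec (Unique ls)
unique? = allPairs? λ a b → ¬? (a ≟ᶠ b)

firstOrder : Fin 6 → List (Fin 5)
firstOrder 0F = 2F ∷ 3F ∷ 4F ∷ []
firstOrder 1F = 2F ∷ 4F ∷ 3F ∷ []
firstOrder 2F = 3F ∷ 2F ∷ 4F ∷ []
firstOrder 3F = 3F ∷ 4F ∷ 2F ∷ []
firstOrder 4F = 4F ∷ 2F ∷ 3F ∷ []
firstOrder 5F = 4F ∷ 3F ∷ 2F ∷ []

midOrder : Bool → List (Fin 6)
midOrder false = 2F ∷ 3F ∷ 5F ∷ []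
midOrder true  = 5F ∷ 3F ∷ 2F ∷ []

lastOrder : Fin 6 → List (Fin 5)
lastOrder 0F = 1F ∷ 2F ∷ 3F ∷ []
lastOrder 1F = 1F ∷ 3F ∷ 2F ∷ []
lastOrder 2F = 2F ∷ 1F ∷ 3F ∷ []
lastOrder 3F = 2F ∷ 3F ∷ 1F ∷ []
lastOrder 4F = 3F ∷ 1F ∷ 2F ∷ []
lastOrder 5F = 3F ∷ 2F ∷ 1F ∷ []

-- Decided by evaluation, and opaque so that no later with-abstraction reruns the decision procedures.
opaque
  firstOrder-linked : ∀ i → Linked (LabelEdge firstEdge) (0F ∷ firstOrder i ∷ʳ 1F)
  firstOrder-linked = from-yes (all? λ i → linked? (labelEdge? firstEdge) (0F ∷ firstOrder i ∷ʳ 1F))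

  firstOrder-unique : ∀ i → Unique (0F ∷ firstOrder i ∷ʳ 1F)
  firstOrder-unique = from-yes (all? λ i → unique? (0F ∷ firstOrder i ∷ʳ 1F))

  firstOrder-injective : ∀ i j → firstOrder i ≡ firstOrder j → i ≡ j
  firstOrder-injective =
    from-yes (all? λ i → all? λ j → ≡-dec _≟ᶠ_ (firstOrder i) (firstOrder j) →-dec i ≟ᶠ j)

  firstOrder-complete : ∀ a b c → Unique (0F ∷ a ∷ b ∷ c ∷ 1F ∷ []) →
                        ∃ λ i → a ∷ b ∷ c ∷ [] ≡ firstOrder i
  firstOrder-complete = from-yes (all? λ a → all? λ b → all? λ c →
    unique? (0F ∷ a ∷ b ∷ c ∷ 1F ∷ []) →-dec
    any? λ i → ≡-dec _≟ᶠ_ (a ∷ b ∷ c ∷ []) (firstOrder i))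

  midOrder-linked : ∀ β → Linked (LabelEdge midEdge) (4F ∷ midOrder β ∷ʳ 1F)
  midOrder-linked false = from-yes (linked? (labelEdge? midEdge) (4F ∷ midOrder false ∷ʳ 1F))
  midOrder-linked true  = from-yes (linked? (labelEdge? midEdge) (4F ∷ midOrder true ∷ʳ 1F))

  midOrder-unique : ∀ β → Unique (4F ∷ midOrder β ∷ʳ 1F ∷ʳ 0F)
  midOrder-unique false = from-yes (unique? (4F ∷ midOrder false ∷ʳ 1F ∷ʳ 0F))
  midOrder-unique true  = from-yes (unique? (4F ∷ midOrder true ∷ʳ 1F ∷ʳ 0F))

  -- only two of the orders of the labels 2, 3, 5 avoid the missing edge 2–5 (vertices 3 and 6 of the paper)
  midOrder-complete : ∀ a b c → Unique (4F ∷ a ∷ b ∷ c ∷ 1F ∷ 0F ∷ []) →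
                      Linked (LabelEdge midEdge) (4F ∷ a ∷ b ∷ c ∷ 1F ∷ []) →
                      a ∷ b ∷ c ∷ [] ≡ midOrder false ⊎ a ∷ b ∷ c ∷ [] ≡ midOrder true
  midOrder-complete = from-yes (all? λ a → all? λ b → all? λ c →
    unique? (4F ∷ a ∷ b ∷ c ∷ 1F ∷ 0F ∷ []) →-dec
    linked? (labelEdge? midEdge) (4F ∷ a ∷ b ∷ c ∷ 1F ∷ []) →-dec
    (≡-dec _≟ᶠ_ (a ∷ b ∷ c ∷ []) (midOrder false) ⊎-dec ≡-dec _≟ᶠ_ (a ∷ b ∷ c ∷ []) (midOrder true)))

  lastOrder-linked : ∀ i → Linked (LabelEdge lastEdge) (4F ∷ lastOrder i ∷ʳ 0F)
  lastOrder-linked = from-yes (all? λ i → linked? (labelEdge? lastEdge) (4F ∷ lastOrder i ∷ʳ 0F))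

  lastOrder-unique : ∀ i → Unique (4F ∷ lastOrder i ∷ʳ 0F)
  lastOrder-unique = from-yes (all? λ i → unique? (4F ∷ lastOrder i ∷ʳ 0F))

  lastOrder-injective : ∀ i j → lastOrder i ≡ lastOrder j → i ≡ j
  lastOrder-injective =
    from-yes (all? λ i → all? λ j → ≡-dec _≟ᶠ_ (lastOrder i) (lastOrder j) →-dec i ≟ᶠ j)

  lastOrder-complete : ∀ a b c → Unique (4F ∷ a ∷ b ∷ c ∷ 0F ∷ []) →
                       ∃ λ i → a ∷ b ∷ c ∷ [] ≡ lastOrder i
  lastOrder-complete = from-yes (all? λ a → all? λ b → all? λ c →
    unique? (4F ∷ a ∷ b ∷ c ∷ 0F ∷ []) →-dec
    any? λ i → ≡-dec _≟ᶠ_ (a ∷ b ∷ c ∷ []) (lastOrder i))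

-- Canonical Hamiltonian cycles

5+[6d+5+1+r]≡6[1+d]+5+r : ∀ d r → 5 + (6 * d + 5 + suc r) ≡ 6 * suc d + 5 + r
5+[6d+5+1+r]≡6[1+d]+5+r = solve-∀

5+[6m+5+0]≡10+6m : ∀ m → 5 + (6 * m + 5 + 0) ≡ 10 + 6 * m
5+[6m+5+0]≡10+6m = solve-∀

module _ {m : ℕ} where

  midIndex : ∀ d j → suc d + j ≡ m → Fin m
  midIndex d j e = fromℕ< (subst (j <_) e (s≤s (m≤n+m j d)))

  blk-midIndex : ∀ d j e → suc (toℕ (midIndex d j e)) ≡ suc j
  blk-midIndex d j e = cong suc (toℕ-fromℕ< (subst (j <_) e (s≤s (m≤n+m j d))))

  next : ∀ {d j} → suc d + j ≡ m → d + suc j ≡ m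
  next {d} {j} e = trans (+-suc d j) e

  blockVertex : ∀ d j → d + j ≡ m → Fin 5 → Loc m
  blockVertex zero    j _ l = last l
  blockVertex (suc d) j e l = mid (midIndex d j e) (inject₁ l)

  blockVertex-at : ∀ d j e l → At (suc j) (toℕ l) (blockVertex d j e l)
  blockVertex-at zero    j e l = cong suc (sym e) , refl
  blockVertex-at (suc d) j e l = blk-midIndex d j e , toℕ-inject₁ l

  firstPath : Fin 6 → List (Loc m)
  firstPath i = first 0F ∷ map first (firstOrder i) ∷ʳ first 1F

  midPath : Fin m → Bool → List (Loc m)
  midPath k β = mid k 4F ∷ map (mid k) (midOrder β) ∷ʳ mid k 1F

  lastPath : Fin 6 → List (Loc m)
  lastPath i = last 4F ∷ map last (lastOrder i) ∷ʳ last 0F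

  -- The canonical path through the blocks j+1, …, m+1 (of which d = m - j are cocktail-party blocks),
  -- followed by rest; it enters at blockVertex d j e 4F and leaves at blockVertex d j e 0F.
  segment : ∀ d j → d + j ≡ m → Vec Bool d → Fin 6 → List (Loc m) → List (Loc m)
  segment zero    j _ []       i rest = lastPath i ++ rest
  segment (suc d) j e (β ∷ βs) i rest = midPath J β ++ segment d (suc j) (next e) βs i (mid J 0F ∷ rest)
    where J = midIndex d j e

  canonical : Fin 6 → Vec Bool m → Fin 6 → List (Loc m)
  canonical i₁ βs i₂ = firstPath i₁ ++ segment m 0 (+-identityʳ m) βs i₂ []

  firstPath-linked : ∀ i → Linked _~_ (firstPath i)
  firstPath-linked i = subst (Linked _~_ ∘ (first 0F ∷_)) (map-++ first (firstOrder i) [ 1F ])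
    (Linked.map⁺ {f = first} (Linked.map first~ (firstOrder-linked i)))

  midPath-linked : ∀ k β → Linked _~_ (midPath k β)
  midPath-linked k false = Linked.map⁺ {f = mid k} (Linked.map mid~ (midOrder-linked false))
  midPath-linked k true  = Linked.map⁺ {f = mid k} (Linked.map mid~ (midOrder-linked true))

  lastPath-linked : ∀ i → Linked _~_ (lastPath i)
  lastPath-linked i = subst (Linked _~_ ∘ (last 4F ∷_)) (map-++ last (lastOrder i) [ 0F ])
    (Linked.map⁺ {f = last} (Linked.map last~ (lastOrder-linked i)))

  firstPath-unique : ∀ i → Unique (firstPath i)
  firstPath-unique i = subst (Unique ∘ (first 0F ∷_)) (map-++ first (firstOrder i) [ 1F ])
    (Unique.map⁺ first-injective (firstOrder-unique i))

  midPath-unique : ∀ k β → Unique (midPath k β ∷ʳ mid k 0F)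
  midPath-unique k false = Unique.map⁺ mid-injective (midOrder-unique false)
  midPath-unique k true  = Unique.map⁺ mid-injective (midOrder-unique true)

  lastPath-unique : ∀ i → Unique (lastPath i)
  lastPath-unique i = subst (Unique ∘ (last 4F ∷_)) (map-++ last (lastOrder i) [ 0F ])
    (Unique.map⁺ last-injective (lastOrder-unique i))

  All-blk-map : ∀ {k b} (f : Fin k → Loc m) → (∀ l → blk (f l) ≡ b) → ∀ ls →
                All (λ x → blk x ≡ b) (map f ls)
  All-blk-map f f-blk ls = All.map⁺ (All.universal f-blk ls)

  firstPath-blk : ∀ i → All (λ x → blk x ≡ 0) (firstPath i)
  firstPath-blk i = refl ∷ All.∷ʳ⁺ (All-blk-map first (λ _ → refl) (firstOrder i)) refl

  midPath-blk : ∀ k β → All (λ x → blk x ≡ suc (toℕ k)) (midPath k β)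
  midPath-blk k β = refl ∷ All.∷ʳ⁺ (All-blk-map (mid k) (λ _ → refl) (midOrder β)) refl

  lastPath-blk : ∀ i → All (λ x → blk x ≡ suc m) (lastPath i)
  lastPath-blk i = refl ∷ All.∷ʳ⁺ (All-blk-map last (λ _ → refl) (lastOrder i)) refl

  opaque
    length-firstPath : ∀ i → length (firstPath i) ≡ 5
    length-firstPath = from-yes (all? λ i → length (firstPath i) ℕ.≟ 5)

    length-lastPath : ∀ i → length (lastPath i) ≡ 5
    length-lastPath = from-yes (all? λ i → length (lastPath i) ℕ.≟ 5)

  length-midPath : ∀ k β → length (midPath k β) ≡ 5
  length-midPath k false = refl
  length-midPath k true  = refl

  rung-into : ∀ d j e {u} → At j 1 u → u ~ blockVertex d j e 4F
  rung-into d j e (u-blk , u-lab) = Crossing⇒~ (crossing (trans v-blk (cong suc (sym u-blk))) (rung u-lab v-lab))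
    where open Σ (blockVertex-at d j e 4F) renaming (proj₁ to v-blk; proj₂ to v-lab)

  spine-into : ∀ d j e {u} → At j 0 u → u ~ blockVertex d j e 0F
  spine-into d j e (u-blk , u-lab) = Crossing⇒~ (crossing (trans v-blk (cong suc (sym u-blk))) (spine u-lab v-lab))
    where open Σ (blockVertex-at d j e 0F) renaming (proj₁ to v-blk; proj₂ to v-lab)

  segment-++ : ∀ d j e βs i rest ys → segment d j e βs i rest ++ ys ≡ segment d j e βs i (rest ++ ys)
  segment-++ zero    j e []       i rest ys = ++-assoc (lastPath i) rest ys
  segment-++ (suc d) j e (β ∷ βs) i rest ys =
    trans (++-assoc (midPath J β) _ ys)
          (cong (midPath J β ++_) (segment-++ d (suc j) (next e) βs i (mid J 0F ∷ rest) ys))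
    where J = midIndex d j e

  ∈-segment : ∀ d j e βs i rest {x} → x ∈ segment d j e βs i rest → suc j ≤ blk x ⊎ x ∈ rest
  ∈-segment zero j e [] i rest x∈ with ∈-++⁻ (lastPath i) x∈
  ... | inj₁ x∈path = inj₁ (≤-reflexive (trans (cong suc e) (sym (All.lookup (lastPath-blk i) x∈path))))
  ... | inj₂ x∈rest = inj₂ x∈rest
  ∈-segment (suc d) j e (β ∷ βs) i rest x∈ with ∈-++⁻ (midPath (midIndex d j e) β) x∈
  ... | inj₁ x∈path =
    inj₁ (≤-reflexive (trans (sym (blk-midIndex d j e)) (sym (All.lookup (midPath-blk _ β) x∈path))))
  ... | inj₂ x∈seg with ∈-segment d (suc j) (next e) βs i (mid (midIndex d j e) 0F ∷ rest) x∈seg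
  ...   | inj₁ above          = inj₁ (≤-trans (n≤1+n _) above)
  ...   | inj₂ (here refl)    = inj₁ (≤-reflexive (sym (blk-midIndex d j e)))
  ...   | inj₂ (there x∈rest) = inj₂ x∈rest

  ≡suc⇒≰ : ∀ {a b} → a ≡ suc b → a ≤ b → ⊥
  ≡suc⇒≰ refl = <-irrefl refl

  segment-unique : ∀ d j e βs i rest → Unique rest → All (λ x → blk x ≤ j) rest →
                   Unique (segment d j e βs i rest)
  segment-unique zero j e [] i rest !rest rest≤ = Unique.++⁺ (lastPath-unique i) !rest disjoint
    where
      disjoint : Disjoint (lastPath i) rest
      disjoint (x∈path , x∈rest) =
        ≡suc⇒≰ (trans (All.lookup (lastPath-blk i) x∈path) (cong suc (sym e))) (All.lookup rest≤ x∈rest)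
  segment-unique (suc d) j e (β ∷ βs) i rest !rest rest≤ =
    Unique.++⁺ (Unique-++⁻ˡ (midPath J β) (midPath-unique J β))
      (segment-unique d (suc j) (next e) βs i (mid J 0F ∷ rest) (All.map J0≢ rest≤ ∷ !rest)
        (≤-reflexive (blk-midIndex d j e) ∷ All.map (λ x≤j → ≤-trans x≤j (n≤1+n j)) rest≤))
      disjoint
    where
      J = midIndex d j e
      J0≢ : ∀ {x} → blk x ≤ j → mid J 0F ≢ x
      J0≢ x≤j refl = ≡suc⇒≰ (blk-midIndex d j e) x≤j
      blk-path : ∀ {x} → x ∈ midPath J β → blk x ≡ suc j
      blk-path x∈path = trans (All.lookup (midPath-blk J β) x∈path) (blk-midIndex d j e)
      disjoint : Disjoint (midPath J β) (segment d (suc j) (next e) βs i (mid J 0F ∷ rest))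
      disjoint (x∈path , x∈seg) with ∈-segment d (suc j) (next e) βs i (mid J 0F ∷ rest) x∈seg
      ... | inj₁ above          = <-irrefl refl (≤-trans above (≤-reflexive (blk-path x∈path)))
      ... | inj₂ (here refl)    = Unique-∷ʳ⁻ (midPath J β) (midPath-unique J β) x∈path
      ... | inj₂ (there x∈rest) = ≡suc⇒≰ (blk-path x∈path) (All.lookup rest≤ x∈rest)

  segment-linked : ∀ d j e βs i rest {x} → x ~ blockVertex d j e 4F → Linked _~_ (blockVertex d j e 0F ∷ rest) →
                   Linked _~_ (x ∷ segment d j e βs i rest)
  segment-linked zero j e [] i rest {x} x~ l =
    Linked-∷ʳ-++ (x ∷ last 4F ∷ map last (lastOrder i)) (x~ ∷ lastPath-linked i) l
  segment-linked (suc d) j e (β ∷ βs) i rest {x} x~ l =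
    Linked-∷ʳ-++ (x ∷ mid J 4F ∷ map (mid J) (midOrder β)) (x~ ∷ midPath-linked J β)
      (segment-linked d (suc j) (next e) βs i (mid J 0F ∷ rest) (rung-into d (suc j) (next e) (blk-midIndex d j e , refl))
        (~-sym (spine-into d (suc j) (next e) (blk-midIndex d j e , refl)) ∷ l))
    where J = midIndex d j e

  length-segment : ∀ d j e βs i rest → length (segment d j e βs i rest) ≡ 6 * d + 5 + length rest
  length-segment zero j e [] i rest = trans (length-++ (lastPath i)) (cong (_+ length rest) (length-lastPath i))
  length-segment (suc d) j e (β ∷ βs) i rest = begin
    length (midPath J β ++ segment d (suc j) (next e) βs i (mid J 0F ∷ rest))
      ≡⟨ length-++ (midPath J β) ⟩
    length (midPath J β) + length (segment d (suc j) (next e) βs i (mid J 0F ∷ rest))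
      ≡⟨ cong₂ _+_ (length-midPath J β) (length-segment d (suc j) (next e) βs i (mid J 0F ∷ rest)) ⟩
    5 + (6 * d + 5 + suc (length rest))
      ≡⟨ 5+[6d+5+1+r]≡6[1+d]+5+r d (length rest) ⟩
    6 * suc d + 5 + length rest ∎
    where
      open ≡-Reasoning
      J = midIndex d j e

  firstPath-injective : ∀ {i i′} → firstPath i ≡ firstPath i′ → i ≡ i′
  firstPath-injective {i} {i′} eq = firstOrder-injective i i′
    (map-injective first-injective (∷ʳ-injectiveˡ (map first (firstOrder i)) _ (∷-injectiveʳ eq)))

  midPath-injective : ∀ {k} β β′ → midPath k β ≡ midPath k β′ → β ≡ β′
  midPath-injective false false _  = refl
  midPath-injective true  true  _  = refl
  midPath-injective false true  ()
  midPath-injective true  false ()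

  lastPath-injective : ∀ {i i′} → lastPath i ≡ lastPath i′ → i ≡ i′
  lastPath-injective {i} {i′} eq = lastOrder-injective i i′
    (map-injective last-injective (∷ʳ-injectiveˡ (map last (lastOrder i)) _ (∷-injectiveʳ eq)))

  segment-injective : ∀ d j e βs βs′ i i′ rest → segment d j e βs i rest ≡ segment d j e βs′ i′ rest →
                      βs ≡ βs′ × i ≡ i′
  segment-injective zero j e [] [] i i′ rest eq =
    refl , lastPath-injective (++-cancelʳ rest (lastPath i) (lastPath i′) eq)
  segment-injective (suc d) j e (β ∷ βs) (β′ ∷ βs′) i i′ rest eq
    with ++-injective (midPath J β) (midPath J β′) (trans (length-midPath J β) (sym (length-midPath J β′))) eq
    where J = midIndex d j e
  ... | same-path , same-rest
    with midPath-injective β β′ same-path | segment-injective d (suc j) (next e) βs βs′ i i′ _ same-rest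
  ...   | refl | refl , refl = refl , refl

  canonical-cycle : ∀ i₁ βs i₂ → IsCycle _~_ (canonical i₁ βs i₂)
  canonical-cycle i₁ βs i₂ = unique , linked
    where
      seg : List (Loc m) → List (Loc m)
      seg = segment m 0 (+-identityʳ m) βs i₂
      disjoint : Disjoint (firstPath i₁) (seg [])
      disjoint (x∈path , x∈seg) with ∈-segment m 0 (+-identityʳ m) βs i₂ [] x∈seg
      ... | inj₁ above = contradiction (subst (1 ≤_) (All.lookup (firstPath-blk i₁) x∈path) above) λ ()
      unique : Unique (firstPath i₁ ++ seg [])
      unique = Unique.++⁺ (firstPath-unique i₁) (segment-unique m 0 _ βs i₂ [] [] []) disjoint
      closed : (firstPath i₁ ++ seg []) ∷ʳ first 0F ≡ firstPath i₁ ++ seg [ first 0F ]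
      closed = trans (++-assoc (firstPath i₁) (seg []) [ first 0F ])
                     (cong (firstPath i₁ ++_) (segment-++ m 0 _ βs i₂ [] [ first 0F ]))
      linked : Linked _~_ ((firstPath i₁ ++ seg []) ∷ʳ first 0F)
      linked = subst (Linked _~_) (sym closed)
        (Linked-∷ʳ-++ (first 0F ∷ map first (firstOrder i₁)) (firstPath-linked i₁)
          (segment-linked m 0 _ βs i₂ [ first 0F ] (rung-into m 0 _ (refl , refl))
            (~-sym (spine-into m 0 _ (refl , refl)) ∷ [-])))

  length-canonical : ∀ i₁ βs i₂ → length (canonical i₁ βs i₂) ≡ nV m
  length-canonical i₁ βs i₂ = begin
    length (firstPath i₁ ++ segment m 0 (+-identityʳ m) βs i₂ [])
      ≡⟨ length-++ (firstPath i₁) ⟩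
    length (firstPath i₁) + length (segment m 0 (+-identityʳ m) βs i₂ [])
      ≡⟨ cong₂ _+_ (length-firstPath i₁) (length-segment m 0 (+-identityʳ m) βs i₂ []) ⟩
    5 + (6 * m + 5 + 0)
      ≡⟨ 5+[6m+5+0]≡10+6m m ⟩
    nV m ∎
    where open ≡-Reasoning

  canonical-injective : ∀ {i₁ βs i₂ i₁′ βs′ i₂′} → canonical i₁ βs i₂ ≡ canonical i₁′ βs′ i₂′ →
                        i₁ ≡ i₁′ × βs ≡ βs′ × i₂ ≡ i₂′
  canonical-injective {i₁} {βs} {i₂} {i₁′} {βs′} {i₂′} eq
    with ++-injective (firstPath i₁) (firstPath i₁′)
           (trans (length-firstPath i₁) (sym (length-firstPath i₁′))) eq
  ... | same-path , same-segment with segment-injective m 0 (+-identityʳ m) βs βs′ i₂ i₂′ [] same-segment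
  ...   | refl , refl = firstPath-injective same-path , refl , refl

-- Every Hamiltonian cycle is canonical

module _ {m : ℕ} where

  -- Q is the interior of a Hamiltonian path from s to t in the subgraph induced by the blocks ≥ b
  -- (of a Hamiltonian cycle of it through s, when s ≡ t).
  record Tour (b : ℕ) (s : Loc m) (Q : List (Loc m)) (t : Loc m) : Set where
    field
      linked : Linked _~_ (s ∷ Q ∷ʳ t)
      unique : Unique (s ∷ Q)
      t∉Q    : t ∉ Q
      above  : All (λ x → b ≤ blk x) Q
      covers : ∀ x → b ≤ blk x → x ∈ s ∷ Q ∷ʳ t

  StartsIn : ℕ → List (Loc m) → Set
  StartsIn b []      = ⊥
  StartsIn b (x ∷ _) = blk x ≡ b

  startsIn? : ∀ b xs → Dec (StartsIn b xs)
  startsIn? b []      = no λ ()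
  startsIn? b (x ∷ _) = blk x ℕ.≟ b

  record Excursion (b : ℕ) (s : Loc m) (Q : List (Loc m)) (t a c c′ : Loc m) : Set where
    field
      inside        : List (Loc m)
      outside       : List (Loc m)
      shape         : Q ≡ (inside ∷ʳ a) ++ c ∷ outside ∷ʳ c′
      in-block      : All (λ x → blk x ≡ b) inside
      block-unique  : Unique (s ∷ inside ∷ʳ a)
      t∉block       : t ∉ inside ∷ʳ a
      block-covered : ∀ x → blk x ≡ b → x ∈ s ∷ inside ∷ʳ a ∷ʳ t
      rest          : Tour (suc b) c outside c′

  -- The only edges from block b upwards are a–c and t–c′.  A tour of the blocks ≥ b that starts inside
  -- block b can therefore leave it only through a–c, cannot come back through t–c′ before its end, and
  -- cannot come back through a–c at all: it is an excursion.
  module Exit {b : ℕ} {s t a c c′ : Loc m} (s-blk : blk s ≡ b)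
              (t-at : At b 0 t) (a-at : At b 1 a) (c-at : At (suc b) 4 c) (c′-at : At (suc b) 0 c′) where

    upward : ∀ {x y} → x ~ y → blk x ≡ b → b < blk y → (x ≡ t × y ≡ c′) ⊎ (x ≡ a × y ≡ c)
    upward x~y x-blk b<y with ~-upward x~y (subst (_< _) (sym x-blk) b<y)
    ... | crossing next (spine x-lab y-lab) =
      inj₁ (At-unique (x-blk , x-lab) t-at , At-unique (trans next (cong suc x-blk) , y-lab) c′-at)
    ... | crossing next (rung x-lab y-lab)  =
      inj₂ (At-unique (x-blk , x-lab) a-at , At-unique (trans next (cong suc x-blk) , y-lab) c-at)

    t≢a : t ≢ a
    t≢a t≡a = contradiction (trans (sym (proj₂ t-at)) (trans (cong lab t≡a) (proj₂ a-at))) λ ()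

    above-b : ∀ {x : Loc m} → b ≤ blk x → blk x ≢ b → b < blk x
    above-b b≤x x≢b = ℕ.≤∧≢⇒< b≤x (x≢b ∘ sym)

    in-block-not-above : ∀ {x : Loc m} → blk x ≡ b → b < blk x → ⊥
    in-block-not-above x-blk = <-irrefl (sym x-blk)

    c-above : b < blk c
    c-above = ≤-reflexive (sym (proj₁ c-at))

    starts-at-entry : ∀ {Q} → lab s ≡ 4 → Tour b s Q t → StartsIn b Q
    starts-at-entry {[]} _ tour with Tour.covers tour c (ℕ.<⇒≤ c-above)
    ... | here c≡s         = in-block-not-above (trans (cong blk c≡s) s-blk) c-above
    ... | there (here c≡t) = in-block-not-above (trans (cong blk c≡t) (proj₁ t-at)) c-above
    starts-at-entry {x ∷ _} s-lab tour with blk x ℕ.≟ b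
    ... | yes x-blk = x-blk
    ... | no  x≢b with upward (Linked.head (Tour.linked tour)) s-blk (above-b (All.head (Tour.above tour)) x≢b)
    ...   | inj₁ (s≡t , _) = contradiction (trans (sym s-lab) (trans (cong lab s≡t) (proj₂ t-at))) λ ()
    ...   | inj₂ (s≡a , _) = contradiction (trans (sym s-lab) (trans (cong lab s≡a) (proj₂ a-at))) λ ()

    leaves-block : ∀ {Q} → Tour b s Q t → ¬ All (λ x → blk x ≡ b) Q
    leaves-block {Q} tour Q-in with Tour.covers tour c (ℕ.<⇒≤ c-above)
    ... | here refl = in-block-not-above s-blk c-above
    ... | there c∈ with ∈-++⁻ Q c∈
    ...   | inj₁ c∈Q         = in-block-not-above (All.lookup Q-in c∈Q) c-above
    ...   | inj₂ (here refl) = in-block-not-above (proj₁ t-at) c-above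

    returns-through-c′ : ∀ {P c₁} → Tour b s (P ∷ʳ c₁) t → b < blk c₁ → c₁ ≡ c′
    returns-through-c′ {P} tour b<c₁
      with upward (~-sym (Linked-consecutive (s ∷ P) (Tour.linked tour))) (proj₁ t-at) b<c₁
    ... | inj₁ (_ , c₁≡c′) = c₁≡c′
    ... | inj₂ (t≡a , _)   = ⊥-elim (t≢a t≡a)

    no-early-return : ∀ {I C d D} → Tour b s ((I ∷ʳ a) ++ c ∷ C ++ d ∷ D) t → All (λ x → blk x ≢ b) C →
                      blk d ≡ b → ⊥
    no-early-return {I} {C} {d} {D} tour C-out d-in = refute (upward (~-sym w~d) d-in w-above)
      where
        W = proj₁ (∷⇒∷ʳ c C)
        w = proj₁ (proj₂ (∷⇒∷ʳ c C))
        cC≡Ww : c ∷ C ≡ W ∷ʳ w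
        cC≡Ww = proj₂ (proj₂ (∷⇒∷ʳ c C))
        w~d : w ~ d
        w~d = Linked-consecutive W (subst (λ zs → Linked _~_ (zs ++ d ∷ D)) cC≡Ww
                (Linked-++⁻ʳ (s ∷ I ∷ʳ a)
                  (Linked-++⁻ˡ (s ∷ (I ∷ʳ a) ++ c ∷ C ++ d ∷ D) (Tour.linked tour))))
        cC-above : All (λ x → b < blk x) (c ∷ C)
        cC-above = c-above ∷ All.zipWith (λ (b≤x , x≢b) → above-b b≤x x≢b)
                     (All.++⁻ˡ C (All.tail (All.++⁻ʳ (I ∷ʳ a) (Tour.above tour))) , C-out)
        w-above : b < blk w
        w-above = All.lookup cC-above (subst (w ∈_) (sym cC≡Ww) (∈-++⁺ʳ W (here refl)))
        d∈ : d ∈ c ∷ C ++ d ∷ D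
        d∈ = there (∈-++⁺ʳ C (here refl))
        refute : (d ≡ t × w ≡ c′) ⊎ (d ≡ a × w ≡ c) → ⊥
        refute (inj₁ (d≡t , _)) = Tour.t∉Q tour (∈-++⁺ʳ (I ∷ʳ a) (subst (_∈ c ∷ C ++ d ∷ D) d≡t d∈))
        refute (inj₂ (d≡a , _)) = Unique-++⁻-disjoint (I ∷ʳ a) (AllPairs.tail (Tour.unique tour))
                                    (∈-++⁺ʳ I (here refl) , subst (_∈ c ∷ C ++ d ∷ D) d≡a d∈)

    excursion : ∀ {I C′} → Tour b s ((I ∷ʳ a) ++ c ∷ C′ ∷ʳ c′) t →
                All (λ x → blk x ≡ b) I → All (λ x → blk x ≢ b) (C′ ∷ʳ c′) →
                Excursion b s ((I ∷ʳ a) ++ c ∷ C′ ∷ʳ c′) t a c c′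
    excursion {I} {C′} tour I-in C′-out = record
      { inside        = I
      ; outside       = C′
      ; shape         = refl
      ; in-block      = I-in
      ; block-unique  = Unique-++⁻ˡ (s ∷ I ∷ʳ a) (Tour.unique tour)
      ; t∉block       = Tour.t∉Q tour ∘ ∈-++⁺ˡ
      ; block-covered = block-covered
      ; rest          = record
        { linked = Linked-++⁻ʳ (s ∷ I ∷ʳ a) (Linked-++⁻ˡ (s ∷ (I ∷ʳ a) ++ M) (Tour.linked tour))
        ; unique = Unique-++⁻ˡ (c ∷ C′) !M
        ; t∉Q    = Unique-∷ʳ⁻ (c ∷ C′) !M ∘ there
        ; above  = All.++⁻ˡ C′ (All.tail M-above)
        ; covers = M-covered
        }
      }
      where
        M = c ∷ C′ ∷ʳ c′
        !M : Unique M
        !M = Unique-++⁻ʳ (s ∷ I ∷ʳ a) (Tour.unique tour)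
        M-above : All (λ x → b < blk x) M
        M-above = All.zipWith (λ (b≤x , x≢b) → above-b b≤x x≢b)
          (All.++⁻ʳ (I ∷ʳ a) (Tour.above tour) , (λ c-in → in-block-not-above c-in c-above) ∷ C′-out)
        block-in : All (λ x → blk x ≡ b) (s ∷ I ∷ʳ a)
        block-in = s-blk ∷ All.∷ʳ⁺ I-in (proj₁ a-at)
        visited : ∀ x → b ≤ blk x → x ∈ ((s ∷ I ∷ʳ a) ++ M) ++ [ t ]
        visited = Tour.covers tour
        M-covered : ∀ x → b < blk x → x ∈ M
        M-covered x b<x with ∈-++⁻ ((s ∷ I ∷ʳ a) ++ M) (visited x (ℕ.<⇒≤ b<x))
        ... | inj₂ (here refl) = contradiction b<x (in-block-not-above (proj₁ t-at))
        ... | inj₁ x∈ with ∈-++⁻ (s ∷ I ∷ʳ a) x∈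
        ...   | inj₁ x∈block = contradiction b<x (in-block-not-above (All.lookup block-in x∈block))
        ...   | inj₂ x∈M     = x∈M
        block-covered : ∀ x → blk x ≡ b → x ∈ s ∷ I ∷ʳ a ∷ʳ t
        block-covered x x-blk with ∈-++⁻ ((s ∷ I ∷ʳ a) ++ M) (visited x (≤-reflexive (sym x-blk)))
        ... | inj₂ x∈t = ∈-++⁺ʳ (s ∷ I ∷ʳ a) x∈t
        ... | inj₁ x∈ with ∈-++⁻ (s ∷ I ∷ʳ a) x∈
        ...   | inj₁ x∈block = ∈-++⁺ˡ x∈block
        ...   | inj₂ x∈M     = contradiction (All.lookup M-above x∈M) (in-block-not-above x-blk)

    closing : ∀ {I R} → Tour b s ((I ∷ʳ a) ++ c ∷ R) t →
              All (λ x → blk x ≡ b) I → All (λ x → blk x ≢ b) R →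
              Excursion b s ((I ∷ʳ a) ++ c ∷ R) t a c c′
    closing {I} {R} tour I-in R-out with initLast R
    ... | [] = contradiction (trans (sym (proj₂ c-at)) (trans (cong lab c≡c′) (proj₂ c′-at))) λ ()
      where c≡c′ = returns-through-c′ tour c-above
    ... | C′ ∷ʳ′ c₁
      with returns-through-c′ (subst (λ Q → Tour b s Q t) (sym (++-assoc (I ∷ʳ a) (c ∷ C′) [ c₁ ])) tour)
             (above-b (proj₂ (All.∷ʳ⁻ (All.tail (All.++⁻ʳ (I ∷ʳ a) (Tour.above tour))))) (proj₂ (All.∷ʳ⁻ R-out)))
    ...   | refl = excursion tour I-in R-out

    after-exit : ∀ {I R} → Tour b s ((I ∷ʳ a) ++ c ∷ R) t → All (λ x → blk x ≡ b) I →
                 Excursion b s ((I ∷ʳ a) ++ c ∷ R) t a c c′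
    after-exit {R = R} tour I-in with first-failure (λ x → swap (toSum (blk x ℕ.≟ b))) R
    ... | inj₂ R-out   = closing tour I-in R-out
    ... | inj₁ returns with toView returns
    ...   | _++ᶠ_∷_ C-out d-in _ = ⊥-elim (no-early-return tour C-out d-in)

    leave : ∀ {Q} → Tour b s Q t → StartsIn b Q → Excursion b s Q t a c c′
    leave {Q} tour starts with first-failure (λ x → toSum (blk x ℕ.≟ b)) Q
    ... | inj₂ Q-in   = ⊥-elim (leaves-block tour Q-in)
    ... | inj₁ leaves with toView leaves
    ...   | _++ᶠ_∷_ {xs = P} P-in c₀-out R with initLast P
    ...     | []       = ⊥-elim (c₀-out starts)
    ...     | I ∷ʳ′ a₀
      with upward (Linked-consecutive (s ∷ I) (Linked-++⁻ˡ (s ∷ P ++ _ ∷ R) (Tour.linked tour)))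
                  (proj₂ (All.∷ʳ⁻ P-in)) (above-b (All.head (All.++⁻ʳ (I ∷ʳ a₀) (Tour.above tour))) c₀-out)
    ...       | inj₁ (refl , _)    = ⊥-elim (Tour.t∉Q tour (∈-++⁺ˡ (∈-++⁺ʳ I (here refl))))
    ...       | inj₂ (refl , refl) = after-exit tour (proj₁ (All.∷ʳ⁻ P-in))

  first-onto : ∀ (x : Loc m) → blk x ≡ 0 → ∃ λ a → x ≡ first a
  first-onto (first a) _ = a , refl

  mid-onto : ∀ k (x : Loc m) → blk x ≡ suc (toℕ k) → ∃ λ a → x ≡ mid k a
  mid-onto k (mid k′ a) eq = a , cong (λ k″ → mid k″ a) (toℕ-injective (suc-injective eq))
  mid-onto k (last _)   eq = contradiction (suc-injective eq) (<⇒≢ (toℕ<n k) ∘ sym)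

  last-onto : ∀ (x : Loc m) → suc m ≤ blk x → ∃ λ a → x ≡ last a
  last-onto (mid k _) (s≤s m≤k) = contradiction (≤-trans (toℕ<n k) m≤k) (<-irrefl refl)
  last-onto (last a)  _         = a , refl

  block-labels : ∀ {k b} (v : Fin k → Loc m) → (∀ {l l′} → v l ≡ v l′ → l ≡ l′) → (∀ l → blk (v l) ≡ b) →
                 ∀ L → Unique (map v L) → (∀ x → blk x ≡ b → x ∈ map v L) →
                 Unique L × length L ≡ k
  block-labels v v-injective v-blk L !vL covered = !L , Unique-complete⇒length≡ !L complete
    where
      !L = Unique.map⁻ !vL
      complete : ∀ l → l ∈ L
      complete l with ∈-map⁻ v (covered (v l) (v-blk l))
      ... | l′ , l′∈L , vl≡vl′ = subst (_∈ L) (sym (v-injective vl≡vl′)) l′∈L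

  firstBlock-order : ∀ {I} → All (λ x → blk x ≡ 0) I → Unique (first 0F ∷ I ∷ʳ first 1F) →
                     (∀ x → blk x ≡ 0 → x ∈ first 0F ∷ I ∷ʳ first 1F) →
                     ∃ λ i → I ≡ map first (firstOrder i)
  firstBlock-order I-in !path covered with All-preimage first (All.map (first-onto _) I-in)
  ... | ls , refl with block-labels first first-injective (λ _ → refl) (0F ∷ ls ∷ʳ 1F)
                         (subst Unique (sym vertices) !path) (λ x x-blk → subst (x ∈_) (sym vertices) (covered x x-blk))
    where vertices = cong (first 0F ∷_) (map-++ first ls [ 1F ])
  ...   | !L , |L|≡5 with length≡3 ls (suc-injective (suc-injective (trans (sym (cong suc (length-∷ʳ ls))) |L|≡5)))
  ...     | p , q , r , refl with firstOrder-complete p q r !L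
  ...       | i , pqr≡ = i , cong (map first) pqr≡

  midBlock-order : ∀ {k I} → All (λ x → blk x ≡ suc (toℕ k)) I →
                   Unique (mid k 4F ∷ I ∷ʳ mid k 1F ∷ʳ mid k 0F) →
                   (∀ x → blk x ≡ suc (toℕ k) → x ∈ mid k 4F ∷ I ∷ʳ mid k 1F ∷ʳ mid k 0F) →
                   Linked _~_ (mid k 4F ∷ I ∷ʳ mid k 1F) → ∃ λ β → I ≡ map (mid k) (midOrder β)
  midBlock-order {k} I-in !path covered linked with All-preimage (mid k) (All.map (mid-onto k _) I-in)
  ... | ls , refl with block-labels (mid k) mid-injective (λ _ → refl) (4F ∷ ls ∷ʳ 1F ∷ʳ 0F)
                         (subst Unique (sym vertices) !path) (λ x x-blk → subst (x ∈_) (sym vertices) (covered x x-blk))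
    where vertices = cong (mid k 4F ∷_) (trans (map-++ (mid k) (ls ∷ʳ 1F) [ 0F ])
                                               (cong (_∷ʳ mid k 0F) (map-++ (mid k) ls [ 1F ])))
  ...   | !L , |L|≡6 with length≡3 ls (suc-injective (suc-injective (suc-injective (trans (sym |L|) |L|≡6))))
    where |L| = cong suc (trans (length-∷ʳ (ls ∷ʳ 1F)) (cong suc (length-∷ʳ ls)))
  ...     | p , q , r , refl with midOrder-complete p q r !L (Linked.map mid~⁻ (Linked.map⁻ linked))
  ...       | inj₁ pqr≡ = false , cong (map (mid k)) pqr≡
  ...       | inj₂ pqr≡ = true  , cong (map (mid k)) pqr≡

  lastBlock-order : ∀ {I} → All (λ x → suc m ≤ blk x) I → Unique (last 4F ∷ I ∷ʳ last 0F) →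
                    (∀ x → blk x ≡ suc m → x ∈ last 4F ∷ I ∷ʳ last 0F) →
                    ∃ λ i → I ≡ map last (lastOrder i)
  lastBlock-order I-above !path covered with All-preimage last (All.map (last-onto _) I-above)
  ... | ls , refl with block-labels last last-injective (λ _ → refl) (4F ∷ ls ∷ʳ 0F)
                         (subst Unique (sym vertices) !path) (λ x x-blk → subst (x ∈_) (sym vertices) (covered x x-blk))
    where vertices = cong (last 4F ∷_) (map-++ last ls [ 0F ])
  ...   | !L , |L|≡5 with length≡3 ls (suc-injective (suc-injective (trans (sym (cong suc (length-∷ʳ ls))) |L|≡5)))
  ...     | p , q , r , refl with lastOrder-complete p q r !L
  ...       | i , pqr≡ = i , cong (map last) pqr≡

  Tour⇒segment : ∀ d j e {Q} → Tour (suc j) (blockVertex d j e 4F) Q (blockVertex d j e 0F) →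
                 ∃₂ λ βs i → blockVertex d j e 4F ∷ Q ∷ʳ blockVertex d j e 0F ≡ segment d j e βs i []
  Tour⇒segment zero j refl tour
    with lastBlock-order (Tour.above tour)
           (Unique-∷ʳ⁺ (Tour.unique tour) λ { (here ()) ; (there t∈Q) → Tour.t∉Q tour t∈Q })
           (λ x x-blk → Tour.covers tour x (≤-reflexive (sym x-blk)))
  ... | i , refl = [] , i , sym (++-identityʳ (lastPath i))
  Tour⇒segment (suc d) j e tour with E.leave tour (E.starts-at-entry refl tour)
    where
      module E = Exit {s = mid (midIndex d j e) 4F} {mid (midIndex d j e) 0F} {mid (midIndex d j e) 1F}
                      {blockVertex d (suc j) (next e) 4F} {blockVertex d (suc j) (next e) 0F}
                      (blk-midIndex d j e) (blk-midIndex d j e , refl) (blk-midIndex d j e , refl)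
                      (blockVertex-at d (suc j) (next e) 4F) (blockVertex-at d (suc j) (next e) 0F)
  ... | record { inside = I ; shape = refl ; in-block = I-in ; block-unique = !B ; t∉block = t∉B
               ; block-covered = covered ; rest = rest }
    with Tour⇒segment d (suc j) (next e) rest
       | midBlock-order (All.map (λ x-blk → trans x-blk (sym (blk-midIndex d j e))) I-in)
                        (Unique-∷ʳ⁺ !B λ { (here ()) ; (there t∈) → t∉B t∈ })
                        (λ x x-blk → covered x (trans x-blk (blk-midIndex d j e)))
                        (Linked-++⁻ˡ (mid (midIndex d j e) 4F ∷ I ∷ʳ mid (midIndex d j e) 1F)
                          (Linked-++⁻ˡ (mid (midIndex d j e) 4F ∷ (I ∷ʳ mid (midIndex d j e) 1F) ++ _)
                            (Tour.linked tour)))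
  ... | βs , i , seg≡ | β , refl = β ∷ βs , i ,
    trans (++-assoc (midPath J β) _ [ mid J 0F ])
          (cong (midPath J β ++_)
            (trans (cong (_∷ʳ mid J 0F) seg≡) (segment-++ d (suc j) (next e) βs i [] [ mid J 0F ])))
    where J = midIndex d j e

  rooted⇒canonical : ∀ {xs : List (Loc m)} → IsCycle _~_ (first 0F ∷ xs) → (∀ x → x ∈ first 0F ∷ xs) →
                     StartsIn 0 xs → ∃₂ λ i₁ βs → ∃ λ i₂ → first 0F ∷ xs ≡ canonical i₁ βs i₂
  rooted⇒canonical {xs} (!xs , linked) complete starts with E.leave tour starts
    where
      module E = Exit {s = first 0F} {first 0F} {first 1F}
                      {blockVertex m 0 (+-identityʳ m) 4F} {blockVertex m 0 (+-identityʳ m) 0F}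
                      refl (refl , refl) (refl , refl)
                      (blockVertex-at m 0 (+-identityʳ m) 4F) (blockVertex-at m 0 (+-identityʳ m) 0F)
      tour : Tour 0 (first 0F) xs (first 0F)
      tour = record
        { linked = linked
        ; unique = !xs
        ; t∉Q    = Unique.Unique[x∷xs]⇒x∉xs !xs
        ; above  = All.universal (λ _ → z≤n) xs
        ; covers = λ x _ → ∈-++⁺ˡ (complete x)
        }
  ... | record { inside = I ; shape = refl ; in-block = I-in ; block-unique = !B ; block-covered = covered ; rest = rest }
    with Tour⇒segment m 0 (+-identityʳ m) rest
       | firstBlock-order I-in !B (λ x x-blk → ∈-∷ʳ-repeat (I ∷ʳ first 1F) (covered x x-blk))
  ... | βs , i₂ , seg≡ | i₁ , refl = i₁ , βs , i₂ , cong (firstPath i₁ ++_) seg≡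

-- Counting Hamiltonian vertex sequences

module _ {m : ℕ} where

  segment-ends : ∀ d j (e : d + j ≡ m) βs i rest →
                 ∃ λ S → segment d j e βs i rest ≡ S ++ blockVertex d j e 0F ∷ rest
  segment-ends zero j e [] i rest =
    last 4F ∷ map last (lastOrder i) , ++-assoc (last 4F ∷ map last (lastOrder i)) [ last 0F ] rest
  segment-ends (suc d) j e (β ∷ βs) i rest with segment-ends d (suc j) (next e) βs i (mid (midIndex d j e) 0F ∷ rest)
  ... | S , seg≡ =
    P ++ S ∷ʳ v , trans (cong (P ++_) seg≡) (sym (trans (++-assoc P (S ∷ʳ v) _) (cong (P ++_) (++-assoc S [ v ] _))))
    where
      P = midPath (midIndex d j e) β
      v = blockVertex d (suc j) (next e) 0F

  canonicalTail : Fin 6 → Vec Bool m → Fin 6 → List (Loc m)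
  canonicalTail i₁ βs i₂ = (map first (firstOrder i₁) ∷ʳ first 1F) ++ segment m 0 (+-identityʳ m) βs i₂ []

  canonicalTail-forward : ∀ i₁ βs i₂ → StartsIn 0 (canonicalTail i₁ βs i₂)
  canonicalTail-forward i₁ βs i₂ with firstOrder i₁
  ... | []    = refl
  ... | _ ∷ _ = refl

  canonicalTail-backward : ∀ i₁ βs i₂ → ¬ StartsIn 0 (reverse (canonicalTail i₁ βs i₂))
  canonicalTail-backward i₁ βs i₂ starts with segment-ends m 0 (+-identityʳ m) βs i₂ []
  ... | S , seg≡ = contradiction (trans (sym (proj₁ (blockVertex-at m 0 (+-identityʳ m) 0F))) v-blk) λ ()
    where
      X = map first (firstOrder i₁) ∷ʳ first 1F
      v = blockVertex m 0 (+-identityʳ m) 0F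
      tail≡ : canonicalTail i₁ βs i₂ ≡ (X ++ S) ∷ʳ v
      tail≡ = trans (cong (X ++_) seg≡) (sym (++-assoc X S [ v ]))
      v-blk : blk v ≡ 0
      v-blk = subst (StartsIn 0) (reverse-++ (X ++ S) [ v ]) (subst (StartsIn 0 ∘ reverse) tail≡ starts)

  orientation-injective : ∀ d d′ {T T′ : List (Loc m)} → StartsIn 0 T → StartsIn 0 T′ →
                          ¬ StartsIn 0 (reverse T) → ¬ StartsIn 0 (reverse T′) →
                          (if d then reverse T else T) ≡ (if d′ then reverse T′ else T′) → d ≡ d′ × T ≡ T′
  orientation-injective false false _   _    _    _     eq = refl , eq
  orientation-injective true  true  _   _    _    _     eq = refl , reverse-injective eq
  orientation-injective false true  fwd _    _    ¬rev′ eq = contradiction (subst (StartsIn 0) eq fwd) ¬rev′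
  orientation-injective true  false _   fwd′ ¬rev _     eq = contradiction (subst (StartsIn 0) (sym eq) fwd′) ¬rev

  up-from-root : ∀ {x : Loc m} → first 0F ~ x → 0 < blk x → At 1 0 x
  up-from-root f~x 0<x with ~-upward f~x 0<x
  ... | crossing next (spine _ x-lab) = next , x-lab
  ... | crossing next (rung () _)

  -- the two cycle neighbours of first 0F are distinct, and at most one of them lies outside block 0
  reversed-forward : ∀ {ys : List (Loc m)} → IsCycle _~_ (first 0F ∷ ys) → (∀ x → x ∈ first 0F ∷ ys) →
                     ¬ StartsIn 0 ys → StartsIn 0 (reverse ys)
  reversed-forward {[]} _ complete _ with complete (first 1F)
  ... | here ()
  ... | there ()
  reversed-forward {y ∷ []} _ complete y-out with complete (first 1F)
  ... | here ()
  ... | there (here 1≡y) = contradiction (cong blk (sym 1≡y)) y-out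
  reversed-forward {y ∷ y′ ∷ ys} (!ys , linked) complete y-out with ∷⇒∷ʳ y (y′ ∷ ys)
  ... | [] , _ , ()
  ... | w ∷ W , z , eq with blk z ℕ.≟ 0
  ...   | yes z-in = subst (StartsIn 0 ∘ reverse) (sym eq) (subst (StartsIn 0) (sym (reverse-++ (w ∷ W) [ z ])) z-in)
  ...   | no  z-out = contradiction (subst (_∈ w ∷ W) y≡z (here (∷-injectiveˡ eq)))
                        (Unique-∷ʳ⁻ (w ∷ W) (subst Unique eq (AllPairs.tail !ys)))
    where
      z~f : z ~ first 0F
      z~f = Linked-consecutive (first 0F ∷ w ∷ W) (subst (λ l → Linked _~_ (first 0F ∷ l ∷ʳ first 0F)) eq linked)
      y≡z : y ≡ z
      y≡z = At-unique (up-from-root (Linked.head linked) (ℕ.n≢0⇒n>0 y-out))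
                      (up-from-root (~-sym z~f) (ℕ.n≢0⇒n>0 z-out))

  rooted⇒oriented : ∀ {R : List (Loc m)} → IsCycle _~_ (first 0F ∷ R) → (∀ x → x ∈ first 0F ∷ R) →
                    ∃₂ λ d i₁ → ∃₂ λ βs i₂ → orient d (canonical i₁ βs i₂) ≡ first 0F ∷ R
  rooted⇒oriented {R} cycle complete with startsIn? 0 R
  ... | yes forward with rooted⇒canonical cycle complete forward
  ...   | i₁ , βs , i₂ , R≡ = false , i₁ , βs , i₂ , sym R≡
  rooted⇒oriented {R} cycle complete | no backward
    with rooted⇒canonical (IsCycle-reverse ~-sym (first 0F) R cycle)
                          (λ x → ∈-resp-↭ (prep (first 0F) (↭-sym (↭-reverse R))) (complete x))
                          (reversed-forward cycle complete backward)
  ... | i₁ , βs , i₂ , R≡ = true , i₁ , βs , i₂ ,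
    cong (first 0F ∷_) (trans (cong reverse (sym (∷-injectiveʳ R≡))) (reverse-involutive R))

  -- direction, position of first 0F, orders in the first and last block, choices in the cocktail-party blocks
  Parameters : Set
  Parameters = (Bool × Fin (nV m)) × ((Fin 6 × Fin 6) × Vec Bool m)

  decode : Parameters → List (Loc m)
  decode ((d , r) , ((i₁ , i₂) , βs)) = rotateTo (toℕ r) (orient d (canonical i₁ βs i₂))

  decode-cycle : ∀ p → IsCycle _~_ (decode p)
  decode-cycle ((d , r) , ((i₁ , i₂) , βs)) =
    IsCycle-rotateTo (toℕ r) (orient d (canonical i₁ βs i₂))
      (IsCycle-orient ~-sym d (canonical i₁ βs i₂) (canonical-cycle i₁ βs i₂))

  length-decode : ∀ p → length (decode p) ≡ nV m
  length-decode ((d , r) , ((i₁ , i₂) , βs)) = begin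
    length (rotateTo (toℕ r) (orient d (canonical i₁ βs i₂))) ≡⟨ length-rotateTo (toℕ r) _ ⟩
    length (orient d (canonical i₁ βs i₂))                   ≡⟨ length-orient d (canonical i₁ βs i₂) ⟩
    length (canonical i₁ βs i₂)                              ≡⟨ length-canonical i₁ βs i₂ ⟩
    nV m                                                     ∎
    where open ≡-Reasoning

  decode-injective : ∀ {p p′} → decode p ≡ decode p′ → p ≡ p′
  decode-injective {p@((d , r) , ((i₁ , i₂) , βs))} {p′@((d′ , r′) , ((i₁′ , i₂′) , βs′))} eq
    with rotateTo-injective (toℕ r) (toℕ r′) (bound d r i₁ βs i₂) (bound d′ r′ i₁′ βs′ i₂′)
           (IsCycle⇒Unique (decode-cycle p)) (IsCycle⇒Unique (decode-cycle p′)) eq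
    where
      bound : ∀ d (r : Fin (nV m)) i₁ βs i₂ →
              toℕ r ≤ length (if d then reverse (canonicalTail i₁ βs i₂) else canonicalTail i₁ βs i₂)
      bound d r i₁ βs i₂ = s≤s⁻¹ (subst (toℕ r <_) (sym length≡) (toℕ<n r))
        where length≡ = trans (length-orient d (canonical i₁ βs i₂)) (length-canonical i₁ βs i₂)
  ... | r≡r′ , tails≡
    with orientation-injective d d′ (canonicalTail-forward i₁ βs i₂) (canonicalTail-forward i₁′ βs′ i₂′)
           (canonicalTail-backward i₁ βs i₂) (canonicalTail-backward i₁′ βs′ i₂′) tails≡
  ... | refl , same-tail with canonical-injective (cong (first 0F ∷_) same-tail)
  ... | refl , refl , refl = cong (λ r → (d , r) , ((i₁ , i₂) , βs)) (toℕ-injective r≡r′)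

  decode-surjective : ∀ {xs : List (Loc m)} → IsCycle _~_ xs → length xs ≡ nV m → ∃ λ p → decode p ≡ xs
  decode-surjective {xs} cycle |xs|≡n with ∈-∃++ (Unique⇒complete (IsCycle⇒Unique cycle) |xs|≡n (first 0F))
  ... | A , B , refl
    with rooted⇒oriented (IsCycle-rotate A (first 0F ∷ B) cycle)
           (λ x → ∈-resp-↭ (++-comm A (first 0F ∷ B)) (Unique⇒complete (IsCycle⇒Unique cycle) |xs|≡n x))
  ...   | d , i₁ , βs , i₂ , oriented≡ =
    ((d , fromℕ< |A|<n) , ((i₁ , i₂) , βs)) ,
    trans (cong₂ rotateTo (toℕ-fromℕ< |A|<n) oriented≡) (rotateTo-split (first 0F) B A)
    where |A|<n = subst (length A <_) |xs|≡n (length<length-++-∷ A)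

  HamSeq↔Parameters : HamSeq m ↔ Parameters
  HamSeq↔Parameters = Σ↔-injection encode encode-injective encode-cycle encode-onto T-irrelevant
    where
      encode : Parameters → Vec (Loc m) (nV m)
      encode p = cast (length-decode p) (fromList (decode p))
      toList-encode : ∀ p → toList (encode p) ≡ decode p
      toList-encode p = trans (toList-cast (length-decode p) (fromList (decode p))) (toList∘fromList (decode p))
      encode-injective : ∀ {p p′} → encode p ≡ encode p′ → p ≡ p′
      encode-injective {p} {p′} eq =
        decode-injective (trans (sym (toList-encode p)) (trans (cong toList eq) (toList-encode p′)))
      encode-cycle : ∀ p → T (isCycleSeq (toList (encode p)))
      encode-cycle p = subst (T ∘ isCycleSeq) (sym (toList-encode p)) (IsCycle⇒isCycleSeq (decode p) (decode-cycle p))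
      encode-onto : ∀ {v} → T (isCycleSeq (toList v)) → ∃ λ p → encode p ≡ v
      encode-onto {v} c with decode-surjective (isCycleSeq⇒IsCycle (toList v) c) (length-toList v)
      ... | p , decode≡ =
        p , trans (sym (cast-is-id refl (encode p))) (toList-injective refl (encode p) v (trans (toList-encode p) decode≡))

Fin[2^m]↔Vec : ∀ m → Fin (2 ^ m) ↔ Vec Bool m
Fin[2^m]↔Vec m = ↔-trans (Fin[m^n]↔Fin[m]^n 2 m) (↔-trans (lift↔ m 2↔Bool) (↔Vec m))

Fin↔Parameters : ∀ m → Fin (2 * nV m * (36 * 2 ^ m)) ↔ Parameters {m}
Fin↔Parameters m =
  ↔-trans *↔× (↔-trans *↔× (2↔Bool ×-↔ ↔-refl) ×-↔ ↔-trans *↔× (*↔× ×-↔ Fin[2^m]↔Vec m))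

36x≡9[2[2x]] : ∀ x → 36 * x ≡ 9 * (2 * (2 * x))
36x≡9[2[2x]] = solve-∀

10+6m+2≡[2+m]*6 : ∀ m → 10 + 6 * m + 2 ≡ (2 + m) * 6
10+6m+2≡[2+m]*6 = solve-∀

36*2^m≡9*2^[[nV+2]/6] : ∀ m → 36 * 2 ^ m ≡ 9 * 2 ^ ((nV m + 2) / 6)
36*2^m≡9*2^[[nV+2]/6] m = begin
  36 * 2 ^ m               ≡⟨ 36x≡9[2[2x]] (2 ^ m) ⟩
  9 * 2 ^ (2 + m)          ≡⟨ cong (λ k → 9 * 2 ^ k) (sym [nV+2]/6≡2+m) ⟩
  9 * 2 ^ ((nV m + 2) / 6) ∎
  where
    open ≡-Reasoning
    [nV+2]/6≡2+m : (nV m + 2) / 6 ≡ 2 + m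
    [nV+2]/6≡2+m = trans (cong (_/ 6) (10+6m+2≡[2+m]*6 m)) (m*n/n≡m (2 + m) 6)

-- Degrees

module _ {m : ℕ} where

  -- the vertex with label l in block b, for b ≤ m + 1
  at : ℕ → Fin 5 → Loc m
  at zero    l = first l
  at (suc b) l with b ℕ.<? m
  ... | yes b<m = mid (fromℕ< b<m) (inject₁ l)
  ... | no  _   = last l

  blk≤ : ∀ (x : Loc m) → blk x ≤ suc m
  blk≤ (first _) = z≤n
  blk≤ (mid k _) = s≤s (ℕ.<⇒≤ (toℕ<n k))
  blk≤ (last _)  = ≤-refl

  blk-at : ∀ b l → b ≤ suc m → blk (at b l) ≡ b
  blk-at zero    l _   = refl
  blk-at (suc b) l b≤m with b ℕ.<? m
  ... | yes b<m = cong suc (toℕ-fromℕ< b<m)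
  ... | no  b≮m = cong suc (≤-antisym (ℕ.≮⇒≥ b≮m) (s≤s⁻¹ b≤m))

  lab-at : ∀ b l → lab (at b l) ≡ toℕ l
  lab-at zero    l = refl
  lab-at (suc b) l with b ℕ.<? m
  ... | yes _ = toℕ-inject₁ l
  ... | no  _ = refl

  at-unique : ∀ {x b l} → blk x ≡ b → lab x ≡ toℕ l → x ≡ at b l
  at-unique {x} {b} {l} x-blk x-lab =
    blk-lab-injective (trans x-blk (sym (blk-at b l (subst (_≤ suc m) x-blk (blk≤ x))))) (trans x-lab (sym (lab-at b l)))

  blk-below : ∀ v l → 0 < blk v → blk v ≡ suc (blk (at (pred (blk v)) l))
  blk-below v l 0<v =
    sym (trans (cong suc (blk-at (pred (blk v)) l (≤-trans ℕ.pred[n]≤n (blk≤ v)))) (suc-pred 0<v))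
    where
      suc-pred : ∀ {n} → 0 < n → suc (pred n) ≡ n
      suc-pred (s≤s _) = refl

  up-at : ℕ → ℕ → List (Loc m)
  up-at b 0 = [ at (suc b) 0F ]
  up-at b 1 = [ at (suc b) 4F ]
  up-at b _ = []

  down-at : ℕ → ℕ → List (Loc m)
  down-at b 0 = [ at (pred b) 0F ]
  down-at b 4 = [ at (pred b) 1F ]
  down-at b _ = []

  up down sameBlock neighbours : Loc m → List (Loc m)
  up (last _) = []
  up v        = up-at (blk v) (lab v)
  down (first _) = []
  down v         = down-at (blk v) (lab v)
  sameBlock (first a) = map first   (filter (labelEdge? firstEdge a) (allFin 5))
  sameBlock (mid k a) = map (mid k) (filter (labelEdge? midEdge a) (allFin 6))
  sameBlock (last a)  = map last    (filter (labelEdge? lastEdge a) (allFin 5))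
  neighbours v = sameBlock v ++ down v ++ up v

  ∈-sameBlock⁻ : ∀ v {w} → w ∈ sameBlock v → T (inBlock v w)
  ∈-sameBlock⁻ (first a) w∈ with ∈-map⁻ first w∈
  ... | b , b∈ , refl = proj₂ (∈-filter⁻ (labelEdge? firstEdge a) b∈)
  ∈-sameBlock⁻ (mid k a) w∈ with ∈-map⁻ (mid k) w∈
  ... | b , b∈ , refl = T-∧⁺ (T-≡ᵇ⁺ {toℕ k} refl) (proj₂ (∈-filter⁻ (labelEdge? midEdge a) b∈))
  ∈-sameBlock⁻ (last a) w∈ with ∈-map⁻ last w∈
  ... | b , b∈ , refl = proj₂ (∈-filter⁻ (labelEdge? lastEdge a) b∈)

  ∈-sameBlock⁺ : ∀ v w → T (inBlock v w) → w ∈ sameBlock v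
  ∈-sameBlock⁺ (first a) (first b) e = ∈-map⁺ first (∈-filter⁺ (labelEdge? firstEdge a) (∈-allFin b) e)
  ∈-sameBlock⁺ (mid k a) (mid k′ b) e with T-∧⁻ {toℕ k ≡ᵇ toℕ k′} e
  ... | k≡k′ , e′ with toℕ-injective {i = k} {j = k′} (T-≡ᵇ⁻ k≡k′)
  ... | refl = ∈-map⁺ (mid k) (∈-filter⁺ (labelEdge? midEdge a) (∈-allFin b) e′)
  ∈-sameBlock⁺ (last a) (last b) e = ∈-map⁺ last (∈-filter⁺ (labelEdge? lastEdge a) (∈-allFin b) e)

  ∈-up-at⁻ : ∀ v {w} → blk v ≤ m → w ∈ up-at (blk v) (lab v) → Crossing v w
  ∈-up-at⁻ v {w} v≤m w∈ with lab v in v-lab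
  ∈-up-at⁻ v {w} v≤m (here refl) | 0 =
    crossing (blk-at (suc (blk v)) 0F (s≤s v≤m)) (spine v-lab (lab-at (suc (blk v)) 0F))
  ∈-up-at⁻ v {w} v≤m (here refl) | 1 =
    crossing (blk-at (suc (blk v)) 4F (s≤s v≤m)) (rung v-lab (lab-at (suc (blk v)) 4F))

  ∈-up-at⁺ : ∀ v {w} → Crossing v w → w ∈ up-at (blk v) (lab v)
  ∈-up-at⁺ v {w} (crossing next (spine v-lab w-lab)) rewrite v-lab = here (at-unique next w-lab)
  ∈-up-at⁺ v {w} (crossing next (rung v-lab w-lab))  rewrite v-lab = here (at-unique next w-lab)

  ∈-down-at⁻ : ∀ v {w} → 0 < blk v → w ∈ down-at (blk v) (lab v) → Crossing w v
  ∈-down-at⁻ v {w} 0<v w∈ with lab v in v-lab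
  ∈-down-at⁻ v {w} 0<v (here refl) | 0 = crossing (blk-below v 0F 0<v) (spine (lab-at (pred (blk v)) 0F) v-lab)
  ∈-down-at⁻ v {w} 0<v (here refl) | 4 = crossing (blk-below v 1F 0<v) (rung (lab-at (pred (blk v)) 1F) v-lab)

  ∈-down-at⁺ : ∀ v {w} → Crossing w v → w ∈ down-at (blk v) (lab v)
  ∈-down-at⁺ v {w} (crossing next (spine w-lab v-lab)) rewrite v-lab = here (at-unique (cong pred (sym next)) w-lab)
  ∈-down-at⁺ v {w} (crossing next (rung w-lab v-lab))  rewrite v-lab = here (at-unique (cong pred (sym next)) w-lab)

  ∈-up⁻ : ∀ v {w} → w ∈ up v → Crossing v w
  ∈-up⁻ (first a) w∈ = ∈-up-at⁻ (first a) z≤n w∈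
  ∈-up⁻ (mid k a) w∈ = ∈-up-at⁻ (mid k a) (toℕ<n k) w∈

  ∈-up⁺ : ∀ v {w} → Crossing v w → w ∈ up v
  ∈-up⁺ (first a) c = ∈-up-at⁺ (first a) c
  ∈-up⁺ (mid k a) c = ∈-up-at⁺ (mid k a) c
  ∈-up⁺ (last a) {w} (crossing next _) = contradiction (subst (_≤ suc m) next (blk≤ w)) (<-irrefl refl)

  ∈-down⁻ : ∀ v {w} → w ∈ down v → Crossing w v
  ∈-down⁻ (mid k a) w∈ = ∈-down-at⁻ (mid k a) (s≤s z≤n) w∈
  ∈-down⁻ (last a)  w∈ = ∈-down-at⁻ (last a) (s≤s z≤n) w∈

  ∈-down⁺ : ∀ v {w} → Crossing w v → w ∈ down v
  ∈-down⁺ (first a) (crossing () _)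
  ∈-down⁺ (mid k a) c = ∈-down-at⁺ (mid k a) c
  ∈-down⁺ (last a)  c = ∈-down-at⁺ (last a) c

  ∈-neighbours⁺ : ∀ v {w} → v ~ w → w ∈ neighbours v
  ∈-neighbours⁺ v {w} v~w with ~-cases v~w
  ... | inj₁ same        = ∈-++⁺ˡ (∈-sameBlock⁺ v w same)
  ... | inj₂ (inj₁ up)   = ∈-++⁺ʳ (sameBlock v) (∈-++⁺ʳ (down v) (∈-up⁺ v up))
  ... | inj₂ (inj₂ down) = ∈-++⁺ʳ (sameBlock v) (∈-++⁺ˡ (∈-down⁺ v down))

  ∈-neighbours⁻ : ∀ v {w} → w ∈ neighbours v → v ~ w
  ∈-neighbours⁻ v w∈ with ∈-++⁻ (sameBlock v) w∈
  ... | inj₁ w∈same = edge (T-∨⁺ (inj₁ (∈-sameBlock⁻ v w∈same)))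
  ... | inj₂ w∈rest with ∈-++⁻ (down v) w∈rest
  ...   | inj₁ w∈down = ~-sym (Crossing⇒~ (∈-down⁻ v w∈down))
  ...   | inj₂ w∈up   = Crossing⇒~ (∈-up⁻ v w∈up)

  up-at-unique : ∀ b l → Unique (up-at b l)
  up-at-unique b 0             = [] ∷ []
  up-at-unique b 1             = [] ∷ []
  up-at-unique b (suc (suc _)) = []

  down-at-unique : ∀ b l → Unique (down-at b l)
  down-at-unique b 0                               = [] ∷ []
  down-at-unique b 1                               = []
  down-at-unique b 2                               = []
  down-at-unique b 3                               = []
  down-at-unique b 4                               = [] ∷ []
  down-at-unique b (suc (suc (suc (suc (suc _))))) = []

  neighbours-unique : ∀ v → Unique (neighbours v)
  neighbours-unique v = Unique.++⁺ (sameBlock-unique v) (Unique.++⁺ (down-unique v) (up-unique v) down∩up) same∩rest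
    where
      sameBlock-unique : ∀ v → Unique (sameBlock v)
      sameBlock-unique (first a) =
        Unique.map⁺ first-injective (Unique.filter⁺ (labelEdge? firstEdge a) (Unique.allFin⁺ 5))
      sameBlock-unique (mid k a) =
        Unique.map⁺ mid-injective (Unique.filter⁺ (labelEdge? midEdge a) (Unique.allFin⁺ 6))
      sameBlock-unique (last a)  =
        Unique.map⁺ last-injective (Unique.filter⁺ (labelEdge? lastEdge a) (Unique.allFin⁺ 5))
      up-unique : ∀ v → Unique (up v)
      up-unique (first a) = up-at-unique 0 (toℕ a)
      up-unique (mid k a) = up-at-unique (suc (toℕ k)) (toℕ a)
      up-unique (last a)  = []
      down-unique : ∀ v → Unique (down v)
      down-unique (first a) = []
      down-unique (mid k a) = down-at-unique (suc (toℕ k)) (toℕ a)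
      down-unique (last a)  = down-at-unique (suc m) (toℕ a)
      down∩up : Disjoint (down v) (up v)
      down∩up (w∈down , w∈up) = <-asym (≤-reflexive (sym (Crossing.next (∈-up⁻ v w∈up))))
                                       (≤-reflexive (sym (Crossing.next (∈-down⁻ v w∈down))))
      same∩rest : Disjoint (sameBlock v) (down v ++ up v)
      same∩rest {w} (w∈same , w∈rest)
        with inBlock⇒same-blk v w (∈-sameBlock⁻ v w∈same) | ∈-++⁻ (down v) w∈rest
      ... | same | inj₁ w∈down = <⇒≢ (n<1+n _) (trans (sym same) (Crossing.next (∈-down⁻ v w∈down)))
      ... | same | inj₂ w∈up   = <⇒≢ (n<1+n _) (trans same (Crossing.next (∈-up⁻ v w∈up)))

  opaque
    length-neighbours : ∀ v → length (neighbours v) ≡ 4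
    length-neighbours (first a) = from-yes (all? λ a → length (neighbours (first a)) ℕ.≟ 4) a
    length-neighbours (mid k a) = from-yes (all? λ a → length (neighbours (mid k a)) ℕ.≟ 4) a
    length-neighbours (last a)  = from-yes (all? λ a → length (neighbours (last a)) ℕ.≟ 4) a

  degree : ∀ v → Nbr v ↔ Fin 4
  degree v = subst (λ n → Nbr v ↔ Fin n) (length-neighbours v)
    (Σ↔Fin-enumeration (neighbours v) (neighbours-unique v)
      (∈-neighbours⁺ v ∘ edge) (_~_.isEdge ∘ ∈-neighbours⁻ v) T-irrelevant)

lemma1 : (m : ℕ) → 1 ≤ m →
    (Loc m ↔ Fin (nV m))
    × ((v : Loc m) → Nbr v ↔ Fin 4)
    × (HamSeq m ↔ Fin (2 * nV m * (36 * 2 ^ m)))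
    × (36 * 2 ^ m ≡ 9 * 2 ^ ((nV m + 2) / 6))
lemma1 m _ = Loc↔Fin , degree , ↔-trans HamSeq↔Parameters (↔-sym (Fin↔Parameters m)) , 36*2^m≡9*2^[[nV+2]/6] m
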